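{- For any $u,v\in\mathfrak{H}^{\ge2}$, we have $R(u,v)\in\mathfrak{H}^{\ge2}$.
   Context: $\mathfrak{H}^1=\mathbb{Q}\langle z_k\mid k\ge1\rangle\cong\mathbb{Q}+\mathbb{Q}\langle x,y\rangle y$ via $z_k=x^{k-1}y$, with harmonic product $\ast$ and shuffle product $\sqcup\!\sqcup$; $\mathfrak{H}^{\ge2}=\mathbb{Q}\langle z_k\mid k\ge2\rangle$. $\varphi(w)=w\ast z_2-w\sqcup\!\sqcup z_2$ and $R(u,v)=\varphi(u\ast v)-\varphi(u)\ast v-u\ast\varphi(v)$. -}

module Defs where

open import Data.Nat using (ℕ; zero; suc; _+_; _≤_)
open import Data.Nat.Properties using () renaming (_≟_ to _≟ℕ_)
open import Data.Rational using (ℚ; 0ℚ; 1ℚ; -_) renaming (_+_ to _+ℚ_; _*_ to _*ℚ_)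
open import Data.List using (List; []; _∷_; _++_; map; concatMap)
open import Data.List.Properties using (≡-dec)
open import Data.List.Relation.Unary.All using (All)
open import Data.Product using (_×_; _,_)
open import Relation.Nullary using (¬_; yes; no)
open import Relation.Binary.PropositionalEquality using (_≡_)

-- Words in the letters z_k (k ≥ 1).
-- CONVENTION: the natural number n as a letter stands for z_(n+1).
-- So z_1 is the letter 0, z_2 is the letter 1, and z_k (k ≥ 2) is a
-- letter n with 1 ≤ n.

Word : Set
Word = List ℕ

-- Elements of 𝔥¹ = ℚ⟨z_k | k ≥ 1⟩: finite formal ℚ-linear combinations
-- of words (a list of (coefficient, word) pairs; the element is the sum).
Poly : Set
Poly = List (ℚ × Word)

word : Word → Poly
word w = (1ℚ , w) ∷ []

_⊕_ : Poly → Poly → Poly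
p ⊕ q = p ++ q

scale : ℚ → Poly → Poly
scale c p = map (λ { (a , w) → (c *ℚ a , w) }) p

⊖_ : Poly → Poly
⊖ p = scale (- 1ℚ) p

_⊖_ : Poly → Poly → Poly
p ⊖ q = p ⊕ (⊖ q)

prefix : ℕ → Poly → Poly
prefix a p = map (λ { (c , w) → (c , a ∷ w) }) p

bilin : (Word → Word → Poly) → Poly → Poly → Poly
bilin f p q =
  concatMap (λ { (a , u) → concatMap (λ { (b , v) → scale (a *ℚ b) (f u v) }) q }) p

coeff : Poly → Word → ℚ
coeff [] w = 0ℚ
coeff ((c , u) ∷ p) w with ≡-dec _≟ℕ_ u w
... | yes _ = c +ℚ coeff p w
... | no  _ = coeff p w

-- Harmonic (stuffle) product:  z_k u ∗ z_l v = z_k (u ∗ z_l v) + z_l (z_k u ∗ v)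
--                                              + z_(k+l) (u ∗ v)
-- With letters a = k-1, b = l-1, the letter of z_(k+l) is a + b + 1.

harmW : Word → Word → Poly
harmW [] v = word v
harmW (a ∷ u) [] = word (a ∷ u)
harmW (a ∷ u) (b ∷ v) =
  prefix a (harmW u (b ∷ v)) ⊕
  (prefix b (harmW (a ∷ u) v) ⊕ prefix (suc (a + b)) (harmW u v))

_∗_ : Poly → Poly → Poly
_∗_ = bilin harmW

-- Shuffle product, computed in ℚ⟨x,y⟩ via z_k = x^(k-1) y.

data XY : Set where
  x y : XY

toXY : Word → List XY
toXY [] = []
toXY (n ∷ w) = xs n (toXY w)
  where
  xs : ℕ → List XY → List XY
  xs zero r = y ∷ r
  xs (suc m) r = x ∷ xs m r

-- Inverse of toXY on words in {x,y}* y ∪ {empty}: reads x^(k-1) y as z_k.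
-- (Trailing x's never occur for the words used below, which lie in ℚ + ℚ⟨x,y⟩y.)
fromXY : List XY → Word
fromXY = go 0
  where
  go : ℕ → List XY → Word
  go n [] = []
  go n (x ∷ r) = go (suc n) r
  go n (y ∷ r) = n ∷ go 0 r

shXY : List XY → List XY → List (List XY)
shXY [] v = v ∷ []
shXY (a ∷ u) [] = (a ∷ u) ∷ []
shXY (a ∷ u) (b ∷ v) = map (a ∷_) (shXY u (b ∷ v)) ++ map (b ∷_) (shXY (a ∷ u) v)

shW : Word → Word → Poly
shW u v = map (λ w → (1ℚ , fromXY w)) (shXY (toXY u) (toXY v))

_⧢_ : Poly → Poly → Poly
_⧢_ = bilin shW

z₂ : Poly
z₂ = word (1 ∷ [])

φ : Poly → Poly
φ w = (w ∗ z₂) ⊖ (w ⧢ z₂)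

R : Poly → Poly → Poly
R u v = (φ (u ∗ v) ⊖ (φ u ∗ v)) ⊖ (u ∗ φ v)

In𝔥≥2 : Poly → Set
In𝔥≥2 p = ∀ w → ¬ (coeff p w ≡ 0ℚ) → All (1 ≤_) w

-- Write z₁Part p for the terms of p whose word contains z₁, so that p ∈ 𝔥≥2 exactly when
-- z₁Part p vanishes. For p ∈ 𝔥≥2 the product p ∗ z₂ stays in 𝔥≥2, while the z₁-part of
-- p ⧢ z₂ is 2δp, where δ(z_k w) = k z_{k+1} insZ₁(w) + z_k δ(w) and insZ₁(w) inserts z₁ at every
-- position of w; hence z₁Part (φ p) = −2δp. Following the recursion of ∗ one shows on words that
-- z₁Part (insZ₁ u ∗ v) = insZ₁ (u ∗ v) and then that δ is a derivation of ∗ modulo z₁: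
-- δ(u ∗ v) = z₁Part (δu ∗ v) + z₁Part (δv ∗ u) on 𝔥≥2. As z₁Part (X ∗ v) only depends on
-- z₁Part X when v ∈ 𝔥≥2, this gives z₁Part (φ(u ∗ v)) = z₁Part (φu ∗ v) + z₁Part (u ∗ φv),
-- which says precisely that R(u, v) has no z₁-part.

module Submission where

open import Defs renaming (_⊕_ to infixr 6 _⊕_)
open import Algebra.Bundles using (CommutativeMonoid)
open import Data.Nat using (ℕ; zero; suc; _≤_; _≤?_; s≤s; z≤n) renaming (_+_ to _+ℕ_)
open import Data.Nat.Properties using (≤-refl; ≤-trans; +-comm; +-suc; +-identityʳ) renaming (_≟_ to _≟ℕ_)
open import Data.Rational using (ℚ; 0ℚ; 1ℚ; -_; _+_; _*_; _≟_)
import Data.Rational.Properties as ℚ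
open import Data.Rational.Solver using (module +-*-Solver)
open import Algebra.Properties.Monoid.Mult ℚ.+-0-monoid using (_×_; ×-homo-1; ×-homo-+)
open import Data.List using (List; []; _∷_; map; filter; length; concatMap)
open import Data.List.Properties
  using (≡-dec; ∷-injectiveˡ; ∷-injectiveʳ; ++-assoc; ++-identityʳ; map-++; concatMap-++;
         filter-++; filter-none; filter-all; length-filter)
open import Data.List.Relation.Unary.All as All using (All; []; _∷_; all?)
open import Data.List.Relation.Unary.All.Properties using (all-filter; ++⁺; map⁺)
open import Data.Product as Product using (_,_; proj₂)
open import Function using (_∘_)
open import Relation.Nullary using (¬_; yes; no; Dec; ¬?; contradiction; decidable-stable)
open import Relation.Unary using (Decidable)
open import Relation.Binary.PropositionalEquality using (_≡_; _≢_; refl; sym; trans; cong; cong₂)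

open +-*-Solver using (_:+_; _:*_; _:=_; con) renaming (solve to ℚ-solve)

-- Poly is an unnormalised list of terms: two elements of 𝔥¹ are equal when all their coefficients agree.
infix 4 _≈_
record _≈_ (p q : Poly) : Set where
  constructor coeffwise
  field coeff-≡ : ∀ w → coeff p w ≡ coeff q w
open _≈_ public

≈-refl : ∀ {p} → p ≈ p
≈-refl = coeffwise λ _ → refl

≈-reflexive : ∀ {p q} → p ≡ q → p ≈ q
≈-reflexive refl = ≈-refl

≈-sym : ∀ {p q} → p ≈ q → q ≈ p
≈-sym p≈q = coeffwise λ w → sym (coeff-≡ p≈q w)

≈-trans : ∀ {p q r} → p ≈ q → q ≈ r → p ≈ r
≈-trans p≈q q≈r = coeffwise λ w → trans (coeff-≡ p≈q w) (coeff-≡ q≈r w)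

coeff-∷-≡ : ∀ c u p w → u ≡ w → coeff ((c , u) ∷ p) w ≡ c + coeff p w
coeff-∷-≡ c u p w u≡w with ≡-dec _≟ℕ_ u w
... | yes _  = refl
... | no u≢w = contradiction u≡w u≢w

coeff-∷-≢ : ∀ c u p w → u ≢ w → coeff ((c , u) ∷ p) w ≡ coeff p w
coeff-∷-≢ c u p w u≢w with ≡-dec _≟ℕ_ u w
... | yes u≡w = contradiction u≡w u≢w
... | no _    = refl

coeff-∷-cong : ∀ c u {p q} w → coeff p w ≡ coeff q w → coeff ((c , u) ∷ p) w ≡ coeff ((c , u) ∷ q) w
coeff-∷-cong c u w eq with ≡-dec _≟ℕ_ u w
... | yes _ = cong (c +_) eq
... | no _  = eq

coeff-++ : ∀ p q w → coeff (p ⊕ q) w ≡ coeff p w + coeff q w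
coeff-++ [] q w = sym (ℚ.+-identityˡ _)
coeff-++ ((c , u) ∷ p) q w with ≡-dec _≟ℕ_ u w
... | yes _ = trans (cong (c +_) (coeff-++ p q w)) (sym (ℚ.+-assoc c _ _))
... | no _  = coeff-++ p q w

coeff-scale : ∀ c p w → coeff (scale c p) w ≡ c * coeff p w
coeff-scale c [] w = sym (ℚ.*-zeroʳ c)
coeff-scale c ((a , u) ∷ p) w with ≡-dec _≟ℕ_ u w
... | yes _ = trans (cong (c * a +_) (coeff-scale c p w)) (sym (ℚ.*-distribˡ-+ c a _))
... | no _  = coeff-scale c p w

coeff-prefix-[] : ∀ a p → coeff (prefix a p) [] ≡ 0ℚ
coeff-prefix-[] a [] = refl
coeff-prefix-[] a ((c , u) ∷ p) = trans (coeff-∷-≢ c (a ∷ u) (prefix a p) [] λ ()) (coeff-prefix-[] a p)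

coeff-prefix-∷ : ∀ a p w → coeff (prefix a p) (a ∷ w) ≡ coeff p w
coeff-prefix-∷ a [] w = refl
coeff-prefix-∷ a ((c , u) ∷ p) w = by-cases (≡-dec _≟ℕ_ u w)
  where
  by-cases : Dec (u ≡ w) → coeff (prefix a ((c , u) ∷ p)) (a ∷ w) ≡ coeff ((c , u) ∷ p) w
  by-cases (yes u≡w) = trans (coeff-∷-≡ c (a ∷ u) (prefix a p) (a ∷ w) (cong (a ∷_) u≡w))
    (trans (cong (c +_) (coeff-prefix-∷ a p w)) (sym (coeff-∷-≡ c u p w u≡w)))
  by-cases (no u≢w) = trans (coeff-∷-≢ c (a ∷ u) (prefix a p) (a ∷ w) (u≢w ∘ ∷-injectiveʳ))
    (trans (coeff-prefix-∷ a p w) (sym (coeff-∷-≢ c u p w u≢w)))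

coeff-prefix-≢ : ∀ {a b} p w → a ≢ b → coeff (prefix a p) (b ∷ w) ≡ 0ℚ
coeff-prefix-≢ [] w a≢b = refl
coeff-prefix-≢ ((c , u) ∷ p) w a≢b =
  trans (coeff-∷-≢ c (_ ∷ u) (prefix _ p) (_ ∷ w) (a≢b ∘ ∷-injectiveˡ)) (coeff-prefix-≢ p w a≢b)

⊕-cong : ∀ {p p′ q q′} → p ≈ p′ → q ≈ q′ → p ⊕ q ≈ p′ ⊕ q′
⊕-cong {p} {p′} {q} {q′} p≈p′ q≈q′ = coeffwise λ w →
  trans (coeff-++ p q w) (trans (cong₂ _+_ (coeff-≡ p≈p′ w) (coeff-≡ q≈q′ w)) (sym (coeff-++ p′ q′ w)))

⊕-comm : ∀ p q → p ⊕ q ≈ q ⊕ p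
⊕-comm p q = coeffwise λ w →
  trans (coeff-++ p q w) (trans (ℚ.+-comm (coeff p w) _) (sym (coeff-++ q p w)))

⊕-commutativeMonoid : CommutativeMonoid _ _
⊕-commutativeMonoid = record
  { Carrier = Poly
  ; _≈_ = _≈_
  ; _∙_ = _⊕_
  ; ε = []
  ; isCommutativeMonoid = record
    { isMonoid = record
      { isSemigroup = record
        { isMagma = record
          { isEquivalence = record { refl = ≈-refl ; sym = ≈-sym ; trans = ≈-trans }
          ; ∙-cong = ⊕-cong
          }
        ; assoc = λ p q r → ≈-reflexive (++-assoc p q r)
        }
      ; identity = (λ _ → ≈-refl) , λ p → ≈-reflexive (++-identityʳ p)
      }
    ; comm = ⊕-comm
    }
  }

open CommutativeMonoid ⊕-commutativeMonoid using (setoid)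
open import Relation.Binary.Reasoning.Setoid setoid
open import Algebra.Properties.CommutativeSemigroup (CommutativeMonoid.commutativeSemigroup ⊕-commutativeMonoid)
  using (interchange; x∙yz≈y∙xz; xy∙z≈x∙zy)
open import Algebra.Solver.CommutativeMonoid ⊕-commutativeMonoid
  using (_⊜_; id) renaming (solve to ⊕-solve; _⊕_ to _⊞_)

scale-cong : ∀ c {p q} → p ≈ q → scale c p ≈ scale c q
scale-cong c {p} {q} p≈q = coeffwise λ w →
  trans (coeff-scale c p w) (trans (cong (c *_) (coeff-≡ p≈q w)) (sym (coeff-scale c q w)))

scale-⊕ : ∀ c p q → scale c (p ⊕ q) ≡ scale c p ⊕ scale c q
scale-⊕ c = map-++ _

scale-scale : ∀ a b p → scale a (scale b p) ≡ scale (a * b) p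
scale-scale a b [] = refl
scale-scale a b ((c , u) ∷ p) = cong₂ _∷_ (cong (_, u) (sym (ℚ.*-assoc a b c))) (scale-scale a b p)

scale-+ : ∀ a b p → scale (a + b) p ≈ scale a p ⊕ scale b p
scale-+ a b p = coeffwise λ w →
  trans (coeff-scale (a + b) p w) (trans (ℚ.*-distribʳ-+ (coeff p w) a b)
    (sym (trans (coeff-++ (scale a p) (scale b p) w) (cong₂ _+_ (coeff-scale a p w) (coeff-scale b p w)))))

scale-1 : ∀ p → scale 1ℚ p ≈ p
scale-1 p = coeffwise λ w → trans (coeff-scale 1ℚ p w) (ℚ.*-identityˡ (coeff p w))

scale-suc : ∀ n p → scale (suc n × 1ℚ) p ≈ p ⊕ scale (n × 1ℚ) p
scale-suc n p = ≈-trans (scale-+ 1ℚ (n × 1ℚ) p) (⊕-cong (scale-1 p) ≈-refl)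

⊖-cong : ∀ {p p′ q q′} → p ≈ p′ → q ≈ q′ → p ⊖ q ≈ p′ ⊖ q′
⊖-cong p≈p′ q≈q′ = ⊕-cong p≈p′ (scale-cong (- 1ℚ) q≈q′)

⊖-⊖-cancel : ∀ {p q r} → p ≈ q ⊕ r → (p ⊖ q) ⊖ r ≈ []
⊖-⊖-cancel {p} {q} {r} p≈q⊕r = coeffwise λ w →
  trans (coeff-++ (p ⊖ q) (⊖ r) w)
  (trans (cong₂ _+_ (trans (coeff-++ p (⊖ q) w) (cong₂ _+_ (coeff-≡ p≈q⊕r w) (coeff-scale (- 1ℚ) q w)))
                    (coeff-scale (- 1ℚ) r w))
  (trans (cong (λ c → (c + - 1ℚ * coeff q w) + - 1ℚ * coeff r w) (coeff-++ q r w))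
         (ℚ-solve 2 (λ a b → ((a :+ b) :+ con (- 1ℚ) :* a) :+ con (- 1ℚ) :* b := con 0ℚ)
                  refl (coeff q w) (coeff r w))))

prefix-cong : ∀ a {p q} → p ≈ q → prefix a p ≈ prefix a q
prefix-cong a {p} {q} p≈q = coeffwise by-cases
  where
  by-cases : ∀ w → coeff (prefix a p) w ≡ coeff (prefix a q) w
  by-cases [] = trans (coeff-prefix-[] a p) (sym (coeff-prefix-[] a q))
  by-cases (b ∷ w) with a ≟ℕ b
  ... | yes refl = trans (coeff-prefix-∷ a p w) (trans (coeff-≡ p≈q w) (sym (coeff-prefix-∷ a q w)))
  ... | no a≢b   = trans (coeff-prefix-≢ p w a≢b) (sym (coeff-prefix-≢ q w a≢b))

prefix-⊕ : ∀ a p q → prefix a (p ⊕ q) ≡ prefix a p ⊕ prefix a q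
prefix-⊕ a = map-++ _

prefix-scale : ∀ a c p → prefix a (scale c p) ≡ scale c (prefix a p)
prefix-scale a c [] = refl
prefix-scale a c ((d , u) ∷ p) = cong ((c * d , a ∷ u) ∷_) (prefix-scale a c p)

module _ {Q : Word → Set} (Q? : Decidable Q) where

  restrict : Poly → Poly
  restrict = filter (Q? ∘ proj₂)

  coeff-restrict : ∀ p {w} → Q w → coeff (restrict p) w ≡ coeff p w
  coeff-restrict [] qw = refl
  coeff-restrict ((c , u) ∷ p) {w} qw with Q? u
  ... | yes qu = coeff-∷-cong c u w (coeff-restrict p qw)
  ... | no ¬qu = trans (coeff-restrict p qw) (sym (coeff-∷-≢ c u p w λ { refl → ¬qu qw }))

  coeff-restrict-¬ : ∀ p {w} → ¬ Q w → coeff (restrict p) w ≡ 0ℚ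
  coeff-restrict-¬ [] ¬qw = refl
  coeff-restrict-¬ ((c , u) ∷ p) {w} ¬qw with Q? u
  ... | yes qu = trans (coeff-∷-≢ c u (restrict p) w λ { refl → ¬qw qu }) (coeff-restrict-¬ p ¬qw)
  ... | no ¬qu = coeff-restrict-¬ p ¬qw

-- Linear and bilinear extension

lin : (Word → Poly) → Poly → Poly
lin f [] = []
lin f ((c , u) ∷ p) = scale c (f u) ⊕ lin f p

pair : (Word → ℚ) → Poly → ℚ
pair G [] = 0ℚ
pair G ((c , u) ∷ p) = c * G u + pair G p

coeff-lin : ∀ f p w → coeff (lin f p) w ≡ pair (λ u → coeff (f u) w) p
coeff-lin f [] w = refl
coeff-lin f ((c , u) ∷ p) w =
  trans (coeff-++ (scale c (f u)) (lin f p) w) (cong₂ _+_ (coeff-scale c (f u) w) (coeff-lin f p w))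

pair-++ : ∀ G p q → pair G (p ⊕ q) ≡ pair G p + pair G q
pair-++ G [] q = sym (ℚ.+-identityˡ _)
pair-++ G ((c , u) ∷ p) q =
  trans (cong (c * G u +_) (pair-++ G p q)) (sym (ℚ.+-assoc (c * G u) (pair G p) (pair G q)))

pair-scale : ∀ G c p → pair G (scale c p) ≡ c * pair G p
pair-scale G c [] = sym (ℚ.*-zeroʳ c)
pair-scale G c ((d , u) ∷ p) = trans (cong (c * d * G u +_) (pair-scale G c p))
  (ℚ-solve 4 (λ c d g s → c :* d :* g :+ c :* s := c :* (d :* g :+ s)) refl c d (G u) (pair G p))

pair-congᶠ : ∀ {G H} p → (∀ u → G u ≡ H u) → pair G p ≡ pair H p
pair-congᶠ [] G≗H = refl
pair-congᶠ ((c , u) ∷ p) G≗H = cong₂ (λ g s → c * g + s) (G≗H u) (pair-congᶠ p G≗H)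

pair-+ᶠ : ∀ G H p → pair (λ u → G u + H u) p ≡ pair G p + pair H p
pair-+ᶠ G H [] = sym (ℚ.+-identityˡ 0ℚ)
pair-+ᶠ G H ((c , u) ∷ p) = trans (cong (c * (G u + H u) +_) (pair-+ᶠ G H p))
  (ℚ-solve 5 (λ c g h s t → c :* (g :+ h) :+ (s :+ t) := (c :* g :+ s) :+ (c :* h :+ t))
    refl c (G u) (H u) (pair G p) (pair H p))

pair-*ᶠ : ∀ d G p → pair (λ u → d * G u) p ≡ d * pair G p
pair-*ᶠ d G [] = sym (ℚ.*-zeroʳ d)
pair-*ᶠ d G ((c , u) ∷ p) = trans (cong (c * (d * G u) +_) (pair-*ᶠ d G p))
  (ℚ-solve 4 (λ c d g s → c :* (d :* g) :+ d :* s := d :* (c :* g :+ s)) refl c d (G u) (pair G p))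

pair-0ᶠ : ∀ p → pair (λ _ → 0ℚ) p ≡ 0ℚ
pair-0ᶠ [] = refl
pair-0ᶠ ((c , u) ∷ p) = trans (cong₂ _+_ (ℚ.*-zeroʳ c) (pair-0ᶠ p)) (ℚ.+-identityˡ 0ℚ)

pair-swap : ∀ (K : Word → Word → ℚ) p q →
            pair (λ u → pair (K u) q) p ≡ pair (λ v → pair (λ u → K u v) p) q
pair-swap K [] q = sym (pair-0ᶠ q)
pair-swap K ((c , u) ∷ p) q = trans (cong₂ _+_ (sym (pair-*ᶠ c (K u) q)) (pair-swap K p q))
  (sym (pair-+ᶠ (λ v → c * K u v) (λ v → pair (λ u′ → K u′ v) p) q))

remove : Word → Poly → Poly
remove u = restrict (λ v → ¬? (≡-dec _≟ℕ_ v u))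

pair-remove : ∀ G u p → pair G p ≡ coeff p u * G u + pair G (remove u p)
pair-remove G u [] = sym (trans (ℚ.+-identityʳ _) (ℚ.*-zeroˡ (G u)))
pair-remove G u ((c , v) ∷ p) with ≡-dec _≟ℕ_ v u
... | yes refl = trans (cong (c * G v +_) (pair-remove G v p))
  (ℚ-solve 4 (λ c g x s → c :* g :+ (x :* g :+ s) := (c :+ x) :* g :+ s)
    refl c (G v) (coeff p v) (pair G (remove v p)))
... | no _ = trans (cong (c * G v +_) (pair-remove G u p))
  (ℚ-solve 5 (λ c g x h s → c :* g :+ (x :* h :+ s) := x :* h :+ (c :* g :+ s))
    refl c (G v) (coeff p u) (G u) (pair G (remove u p)))

-- Removing all terms with the head word does not change the pairing: their coefficients sum to 0.
pair-vanishes : ∀ G p → (∀ w → coeff p w ≡ 0ℚ) → pair G p ≡ 0ℚ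
pair-vanishes G p = bounded (length p) p ≤-refl
  where
  bounded : ∀ n p → length p ≤ n → (∀ w → coeff p w ≡ 0ℚ) → pair G p ≡ 0ℚ
  bounded n [] _ _ = refl
  bounded (suc n) ((c , u) ∷ p) (s≤s |p|≤n) p≈0 =
    trans (cong (c * G u +_) (pair-remove G u p))
    (trans (ℚ-solve 4 (λ c g x s → c :* g :+ (x :* g :+ s) := (c :+ x) :* g :+ s)
              refl c (G u) (coeff p u) (pair G (remove u p)))
    (trans (cong₂ (λ x s → x * G u + s) (trans (sym (coeff-∷-≡ c u p u refl)) (p≈0 u)) rest≈0)
           (trans (ℚ.+-identityʳ _) (ℚ.*-zeroˡ (G u)))))
    where
    rest≈0 : pair G (remove u p) ≡ 0ℚ
    rest≈0 = bounded n (remove u p) (≤-trans (length-filter _ p) |p|≤n) λ w → by-cases w (≡-dec _≟ℕ_ w u)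
      where
      by-cases : ∀ w → Dec (w ≡ u) → coeff (remove u p) w ≡ 0ℚ
      by-cases w (yes w≡u) = coeff-restrict-¬ _ p λ w≢u → w≢u w≡u
      by-cases w (no w≢u) = trans (coeff-restrict _ p w≢u)
        (trans (sym (coeff-∷-≢ c u p w λ u≡w → w≢u (sym u≡w))) (p≈0 w))

pair-cong : ∀ G {p q} → p ≈ q → pair G p ≡ pair G q
pair-cong G {p} {q} p≈q =
  trans (ℚ-solve 2 (λ a b → a := (a :+ con (- 1ℚ) :* b) :+ b) refl (pair G p) (pair G q))
        (trans (cong (_+ pair G q) difference≈0) (ℚ.+-identityˡ _))
  where
  difference≈0 : pair G p + - 1ℚ * pair G q ≡ 0ℚ
  difference≈0 =
    trans (sym (trans (pair-++ G p (scale (- 1ℚ) q)) (cong (pair G p +_) (pair-scale G (- 1ℚ) q))))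
          (pair-vanishes G (p ⊕ scale (- 1ℚ) q) λ w →
             trans (coeff-++ p (scale (- 1ℚ) q) w)
             (trans (cong₂ _+_ (coeff-≡ p≈q w) (coeff-scale (- 1ℚ) q w))
                    (ℚ-solve 1 (λ a → a :+ con (- 1ℚ) :* a := con 0ℚ) refl (coeff q w))))

lin-cong : ∀ {f g p q} → (∀ u → f u ≈ g u) → p ≈ q → lin f p ≈ lin g q
lin-cong {f} {g} {p} {q} f≈g p≈q = coeffwise λ w →
  trans (coeff-lin f p w) (trans (pair-congᶠ p (λ u → coeff-≡ (f≈g u) w))
  (trans (pair-cong _ p≈q) (sym (coeff-lin g q w))))

lin-congˡ : ∀ f {p q} → p ≈ q → lin f p ≈ lin f q
lin-congˡ f = lin-cong (λ _ → ≈-refl)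

lin-congʳ : ∀ {f g} p → (∀ u → f u ≈ g u) → lin f p ≈ lin g p
lin-congʳ p f≈g = lin-cong f≈g (≈-refl {p})

lin-++ : ∀ f p q → lin f (p ⊕ q) ≡ lin f p ⊕ lin f q
lin-++ f [] q = refl
lin-++ f ((c , u) ∷ p) q =
  trans (cong (scale c (f u) ⊕_) (lin-++ f p q)) (sym (++-assoc (scale c (f u)) (lin f p) (lin f q)))

lin-scale : ∀ f c p → lin f (scale c p) ≈ scale c (lin f p)
lin-scale f c p = coeffwise λ w → trans (coeff-lin f (scale c p) w)
  (trans (pair-scale _ c p) (trans (cong (c *_) (sym (coeff-lin f p w))) (sym (coeff-scale c (lin f p) w))))

lin-word : ∀ f u → lin f (word u) ≈ f u
lin-word f u = coeffwise λ w → trans (coeff-lin f (word u) w) (trans (ℚ.+-identityʳ _) (ℚ.*-identityˡ _))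

lin-word-id : ∀ p → lin word p ≈ p
lin-word-id [] = ≈-refl
lin-word-id ((c , u) ∷ p) =
  ⊕-cong (≈-reflexive (cong (λ a → (a , u) ∷ []) (ℚ.*-identityʳ c))) (lin-word-id p)

lin-⊕ᶠ : ∀ f g p → lin (λ u → f u ⊕ g u) p ≈ lin f p ⊕ lin g p
lin-⊕ᶠ f g p = coeffwise λ w → trans (coeff-lin _ p w)
  (trans (pair-congᶠ p (λ u → coeff-++ (f u) (g u) w))
  (trans (pair-+ᶠ _ _ p) (trans (cong₂ _+_ (sym (coeff-lin f p w)) (sym (coeff-lin g p w)))
  (sym (coeff-++ (lin f p) (lin g p) w)))))

lin-scaleᶠ : ∀ d f p → lin (λ u → scale d (f u)) p ≈ scale d (lin f p)
lin-scaleᶠ d f p = coeffwise λ w → trans (coeff-lin _ p w)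
  (trans (pair-congᶠ p (λ u → coeff-scale d (f u) w))
  (trans (pair-*ᶠ d _ p) (trans (cong (d *_) (sym (coeff-lin f p w))) (sym (coeff-scale d (lin f p) w)))))

lin-prefixᶠ : ∀ a f p → lin (λ u → prefix a (f u)) p ≡ prefix a (lin f p)
lin-prefixᶠ a f [] = refl
lin-prefixᶠ a f ((c , u) ∷ p) =
  trans (cong₂ _⊕_ (sym (prefix-scale a c (f u))) (lin-prefixᶠ a f p))
        (sym (prefix-⊕ a (scale c (f u)) (lin f p)))

lin-prefix : ∀ f a p → lin f (prefix a p) ≡ lin (λ u → f (a ∷ u)) p
lin-prefix f a [] = refl
lin-prefix f a ((c , u) ∷ p) = cong (scale c (f (a ∷ u)) ⊕_) (lin-prefix f a p)

lin-lin : ∀ g f p → lin g (lin f p) ≈ lin (λ u → lin g (f u)) p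
lin-lin g f [] = ≈-refl
lin-lin g f ((c , u) ∷ p) = ≈-trans (≈-reflexive (lin-++ g (scale c (f u)) (lin f p)))
  (⊕-cong (lin-scale g c (f u)) (lin-lin g f p))

lin-swap : ∀ (F : Word → Word → Poly) p q →
           lin (λ u → lin (F u) q) p ≈ lin (λ v → lin (λ u → F u v) p) q
lin-swap F p q = coeffwise λ w →
  trans (coeff-lin _ p w) (trans (pair-congᶠ p (λ u → coeff-lin (F u) q w))
  (trans (pair-swap (λ u v → coeff (F u v) w) p q)
  (sym (trans (coeff-lin _ q w) (pair-congᶠ q (λ v → coeff-lin (λ u → F u v) p w))))))

lin-[]ᶠ : ∀ {f} p → (∀ u → f u ≡ []) → lin f p ≡ []
lin-[]ᶠ [] f≡[] = refl
lin-[]ᶠ ((c , u) ∷ p) f≡[] = cong₂ _⊕_ (cong (scale c) (f≡[] u)) (lin-[]ᶠ p f≡[])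

bilin-lin : ∀ F p q → bilin F p q ≡ lin (λ u → lin (F u) q) p
bilin-lin F [] q = refl
bilin-lin F ((a , u) ∷ p) q = cong₂ _⊕_ (row (λ _ _ → refl) q) (bilin-lin F p q)
  where
  -- h stands for the pattern-matching lambda inside bilin, which cannot be named here.
  row : ∀ {h : ℚ Product.× Word → Poly} → (∀ b v → h (b , v) ≡ scale (a * b) (F u v)) →
        ∀ q → concatMap h q ≡ scale a (lin (F u) q)
  row h≡ [] = refl
  row h≡ ((b , v) ∷ q) = trans (cong₂ _⊕_ (trans (h≡ b v) (sym (scale-scale a b (F u v)))) (row h≡ q))
                               (sym (scale-⊕ a (scale b (F u v)) (lin (F u) q)))

bilin-cong : ∀ F {p p′ q q′} → p ≈ p′ → q ≈ q′ → bilin F p q ≈ bilin F p′ q′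
bilin-cong F {p} {p′} {q} {q′} p≈p′ q≈q′ = begin
  bilin F p q                  ≡⟨ bilin-lin F p q ⟩
  lin (λ u → lin (F u) q) p    ≈⟨ lin-cong (λ u → lin-congˡ (F u) q≈q′) p≈p′ ⟩
  lin (λ u → lin (F u) q′) p′  ≡⟨ bilin-lin F p′ q′ ⟨
  bilin F p′ q′                ∎

bilin-⊕ᶠ : ∀ F G p q → bilin (λ u v → F u v ⊕ G u v) p q ≈ bilin F p q ⊕ bilin G p q
bilin-⊕ᶠ F G p q = begin
  bilin (λ u v → F u v ⊕ G u v) p q                      ≡⟨ bilin-lin _ p q ⟩
  lin (λ u → lin (λ v → F u v ⊕ G u v) q) p              ≈⟨ lin-congʳ p (λ u → lin-⊕ᶠ (F u) (G u) q) ⟩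
  lin (λ u → lin (F u) q ⊕ lin (G u) q) p                ≈⟨ lin-⊕ᶠ _ _ p ⟩
  lin (λ u → lin (F u) q) p ⊕ lin (λ u → lin (G u) q) p  ≡⟨ cong₂ _⊕_ (bilin-lin F p q) (bilin-lin G p q) ⟨
  bilin F p q ⊕ bilin G p q                              ∎

bilin-prefixᶠ : ∀ a F p q → bilin (λ u v → prefix a (F u v)) p q ≈ prefix a (bilin F p q)
bilin-prefixᶠ a F p q = begin
  bilin (λ u v → prefix a (F u v)) p q          ≡⟨ bilin-lin _ p q ⟩
  lin (λ u → lin (λ v → prefix a (F u v)) q) p  ≈⟨ lin-congʳ p (λ u → ≈-reflexive (lin-prefixᶠ a (F u) q)) ⟩
  lin (λ u → prefix a (lin (F u) q)) p          ≡⟨ lin-prefixᶠ a _ p ⟩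
  prefix a (lin (λ u → lin (F u) q) p)          ≡⟨ cong (prefix a) (bilin-lin F p q) ⟨
  prefix a (bilin F p q)                        ∎

bilin-prefixˡ : ∀ F a p q → bilin F (prefix a p) q ≡ bilin (λ u → F (a ∷ u)) p q
bilin-prefixˡ F a p q =
  trans (bilin-lin F (prefix a p) q) (trans (lin-prefix _ a p) (sym (bilin-lin _ p q)))

bilin-prefixʳ : ∀ F b p q → bilin F p (prefix b q) ≈ bilin (λ u v → F u (b ∷ v)) p q
bilin-prefixʳ F b p q = begin
  bilin F p (prefix b q)                   ≡⟨ bilin-lin F p (prefix b q) ⟩
  lin (λ u → lin (F u) (prefix b q)) p     ≈⟨ lin-congʳ p (λ u → ≈-reflexive (lin-prefix (F u) b q)) ⟩
  lin (λ u → lin (λ v → F u (b ∷ v)) q) p  ≡⟨ bilin-lin _ p q ⟨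
  bilin (λ u v → F u (b ∷ v)) p q          ∎

bilin-swap : ∀ F p q → bilin F p q ≈ bilin (λ v u → F u v) q p
bilin-swap F p q = begin
  bilin F p q                        ≡⟨ bilin-lin F p q ⟩
  lin (λ u → lin (F u) q) p          ≈⟨ lin-swap F p q ⟩
  lin (λ v → lin (λ u → F u v) p) q  ≡⟨ bilin-lin _ q p ⟨
  bilin (λ v u → F u v) q p          ∎

bilin-wordʳ : ∀ F p v → bilin F p (word v) ≈ lin (λ u → F u v) p
bilin-wordʳ F p v = ≈-trans (≈-reflexive (bilin-lin F p (word v))) (lin-congʳ p (λ u → lin-word (F u) v))

bilin-linˡ : ∀ F f p q → bilin F (lin f p) q ≈ lin (λ u → bilin F (f u) q) p
bilin-linˡ F f p q = begin
  bilin F (lin f p) q                          ≡⟨ bilin-lin F (lin f p) q ⟩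
  lin (λ w → lin (F w) q) (lin f p)            ≈⟨ lin-lin _ f p ⟩
  lin (λ u → lin (λ w → lin (F w) q) (f u)) p  ≈⟨ lin-congʳ p (λ u → ≈-reflexive (sym (bilin-lin F (f u) q))) ⟩
  lin (λ u → bilin F (f u) q) p                ∎

bilin-linʳ : ∀ F f p q → bilin F q (lin f p) ≈ lin (λ u → bilin F q (f u)) p
bilin-linʳ F f p q = begin
  bilin F q (lin f p)                          ≈⟨ bilin-swap F q (lin f p) ⟩
  bilin (λ v u → F u v) (lin f p) q            ≈⟨ bilin-linˡ _ f p q ⟩
  lin (λ u → bilin (λ v w → F w v) (f u) q) p  ≈⟨ lin-congʳ p (λ u → bilin-swap F q (f u)) ⟨
  lin (λ u → bilin F q (f u)) p                ∎

lin-bilin : ∀ g F p q → lin g (bilin F p q) ≈ bilin (λ u v → lin g (F u v)) p q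
lin-bilin g F p q = begin
  lin g (bilin F p q)                        ≡⟨ cong (lin g) (bilin-lin F p q) ⟩
  lin g (lin (λ u → lin (F u) q) p)          ≈⟨ lin-lin g _ p ⟩
  lin (λ u → lin g (lin (F u) q)) p          ≈⟨ lin-congʳ p (λ u → lin-lin g (F u) q) ⟩
  lin (λ u → lin (λ v → lin g (F u v)) q) p  ≡⟨ bilin-lin _ p q ⟨
  bilin (λ u v → lin g (F u v)) p q          ∎

bilin-congᶠ : ∀ {F G} p q → (∀ u v → F u v ≈ G u v) → bilin F p q ≈ bilin G p q
bilin-congᶠ {F} {G} p q F≈G = begin
  bilin F p q                ≡⟨ bilin-lin F p q ⟩
  lin (λ u → lin (F u) q) p  ≈⟨ lin-congʳ p (λ u → lin-congʳ q (F≈G u)) ⟩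
  lin (λ u → lin (G u) q) p  ≡⟨ bilin-lin G p q ⟨
  bilin G p q                ∎

bilin-⊕ˡ : ∀ F p p′ q → bilin F (p ⊕ p′) q ≡ bilin F p q ⊕ bilin F p′ q
bilin-⊕ˡ F p p′ q = concatMap-++ _ p p′

bilin-scaleˡ : ∀ F c p q → bilin F (scale c p) q ≈ scale c (bilin F p q)
bilin-scaleˡ F c p q = begin
  bilin F (scale c p) q                ≡⟨ bilin-lin F (scale c p) q ⟩
  lin (λ u → lin (F u) q) (scale c p)  ≈⟨ lin-scale _ c p ⟩
  scale c (lin (λ u → lin (F u) q) p)  ≡⟨ cong (scale c) (bilin-lin F p q) ⟨
  scale c (bilin F p q)                ∎

bilin-word : ∀ F u v → bilin F (word u) (word v) ≈ F u v
bilin-word F u v = ≈-trans (bilin-wordʳ F (word u) v) (lin-word (λ w → F w v) u)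

harmW-[]ʳ : ∀ u → harmW u [] ≡ word u
harmW-[]ʳ [] = refl
harmW-[]ʳ (a ∷ u) = refl

harmW-comm : ∀ u v → harmW u v ≈ harmW v u
harmW-comm [] [] = ≈-refl
harmW-comm [] (b ∷ v) = ≈-refl
harmW-comm (a ∷ u) [] = ≈-refl
harmW-comm (a ∷ u) (b ∷ v) = begin
  prefix a (harmW u (b ∷ v)) ⊕ prefix b (harmW (a ∷ u) v) ⊕ prefix (suc (a +ℕ b)) (harmW u v)
    ≈⟨ ⊕-cong (prefix-cong a (harmW-comm u (b ∷ v)))
         (⊕-cong (prefix-cong b (harmW-comm (a ∷ u) v))
                 (≈-trans (≈-reflexive (cong (λ n → prefix (suc n) (harmW u v)) (+-comm a b)))
                          (prefix-cong _ (harmW-comm u v)))) ⟩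
  prefix a (harmW (b ∷ v) u) ⊕ prefix b (harmW v (a ∷ u)) ⊕ prefix (suc (b +ℕ a)) (harmW v u)
    ≈⟨ x∙yz≈y∙xz (prefix a (harmW (b ∷ v) u)) (prefix b (harmW v (a ∷ u))) _ ⟩
  prefix b (harmW v (a ∷ u)) ⊕ prefix a (harmW (b ∷ v) u) ⊕ prefix (suc (b +ℕ a)) (harmW v u) ∎

∗-comm : ∀ p q → p ∗ q ≈ q ∗ p
∗-comm p q = ≈-trans (bilin-swap harmW p q) (bilin-congᶠ q p (λ v u → harmW-comm u v))

∗-prefix : ∀ a b p q → prefix a p ∗ prefix b q ≈
           prefix a (p ∗ prefix b q) ⊕ prefix b (prefix a p ∗ q) ⊕ prefix (suc (a +ℕ b)) (p ∗ q)
∗-prefix a b p q = begin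
  prefix a p ∗ prefix b q
    ≡⟨ bilin-prefixˡ harmW a p (prefix b q) ⟩
  bilin (λ u → harmW (a ∷ u)) p (prefix b q)
    ≈⟨ bilin-prefixʳ _ b p q ⟩
  bilin (λ u v → harmW (a ∷ u) (b ∷ v)) p q
    ≈⟨ ≈-trans (bilin-⊕ᶠ _ _ p q) (⊕-cong ≈-refl (bilin-⊕ᶠ _ _ p q)) ⟩
  bilin (λ u v → prefix a (harmW u (b ∷ v))) p q ⊕ bilin (λ u v → prefix b (harmW (a ∷ u) v)) p q
    ⊕ bilin (λ u v → prefix (suc (a +ℕ b)) (harmW u v)) p q
    ≈⟨ ⊕-cong (bilin-prefixᶠ a _ p q) (⊕-cong (bilin-prefixᶠ b _ p q) (bilin-prefixᶠ _ harmW p q)) ⟩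
  prefix a (bilin (λ u v → harmW u (b ∷ v)) p q) ⊕ prefix b (bilin (λ u → harmW (a ∷ u)) p q)
    ⊕ prefix (suc (a +ℕ b)) (p ∗ q)
    ≈⟨ ⊕-cong (prefix-cong a (bilin-prefixʳ harmW b p q))
              (⊕-cong (≈-reflexive (cong (prefix b) (bilin-prefixˡ harmW a p q))) ≈-refl) ⟨
  prefix a (p ∗ prefix b q) ⊕ prefix b (prefix a p ∗ q) ⊕ prefix (suc (a +ℕ b)) (p ∗ q) ∎

∗-identityʳ : ∀ p → p ∗ word [] ≈ p
∗-identityʳ p = begin
  p ∗ word []               ≈⟨ bilin-wordʳ harmW p [] ⟩
  lin (λ u → harmW u []) p  ≈⟨ lin-congʳ p (λ u → ≈-reflexive (harmW-[]ʳ u)) ⟩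
  lin word p                ≈⟨ lin-word-id p ⟩
  p                         ∎

lin-∗ : ∀ f p q → lin f p ∗ q ≈ bilin (λ u v → f u ∗ word v) p q
lin-∗ f p q = begin
  lin f p ∗ q                              ≈⟨ bilin-linˡ harmW f p q ⟩
  lin (λ u → f u ∗ q) p                    ≈⟨ lin-congʳ p (λ u → bilin-cong harmW (≈-refl {f u}) (lin-word-id q)) ⟨
  lin (λ u → f u ∗ lin word q) p           ≈⟨ lin-congʳ p (λ u → bilin-linʳ harmW word q (f u)) ⟩
  lin (λ u → lin (λ v → f u ∗ word v) q) p ≡⟨ bilin-lin _ p q ⟨
  bilin (λ u v → f u ∗ word v) p q         ∎

-- z₁-parts and 𝔥≥2

Z₁Free : Word → Set
Z₁Free = All (1 ≤_)

z₁Free? : Decidable Z₁Free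
z₁Free? = all? (1 ≤?_)

z₁Part : Poly → Poly
z₁Part = restrict (¬? ∘ z₁Free?)

z₁FreePart : Poly → Poly
z₁FreePart = restrict z₁Free?

z₁Part-⊕ : ∀ p q → z₁Part (p ⊕ q) ≡ z₁Part p ⊕ z₁Part q
z₁Part-⊕ = filter-++ _

z₁Part-scale : ∀ c p → z₁Part (scale c p) ≡ scale c (z₁Part p)
z₁Part-scale c [] = refl
z₁Part-scale c ((d , u) ∷ p) with z₁Free? u
... | yes _ = z₁Part-scale c p
... | no _  = cong (_ ∷_) (z₁Part-scale c p)

z₁Part-prefix-suc : ∀ a p → z₁Part (prefix (suc a) p) ≡ prefix (suc a) (z₁Part p)
z₁Part-prefix-suc a [] = refl
z₁Part-prefix-suc a ((c , u) ∷ p) with z₁Free? u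
... | yes _ = z₁Part-prefix-suc a p
... | no _  = cong (_ ∷_) (z₁Part-prefix-suc a p)

z₁Part-prefix-0 : ∀ p → z₁Part (prefix 0 p) ≡ prefix 0 p
z₁Part-prefix-0 [] = refl
z₁Part-prefix-0 ((c , u) ∷ p) = cong (_ ∷_) (z₁Part-prefix-0 p)

z₁Part-prefix-suc-≈ : ∀ a p {q} → z₁Part p ≈ q → z₁Part (prefix (suc a) p) ≈ prefix (suc a) q
z₁Part-prefix-suc-≈ a p z₁p≈q = ≈-trans (≈-reflexive (z₁Part-prefix-suc a p)) (prefix-cong (suc a) z₁p≈q)

z₁Part-prefix-0-≈ : ∀ {p q} → p ≈ q → z₁Part (prefix 0 p) ≈ prefix 0 q
z₁Part-prefix-0-≈ {p} p≈q = ≈-trans (≈-reflexive (z₁Part-prefix-0 p)) (prefix-cong 0 p≈q)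

z₁Part-lin : ∀ f p → z₁Part (lin f p) ≡ lin (z₁Part ∘ f) p
z₁Part-lin f [] = refl
z₁Part-lin f ((c , u) ∷ p) =
  trans (z₁Part-⊕ (scale c (f u)) (lin f p)) (cong₂ _⊕_ (z₁Part-scale c (f u)) (z₁Part-lin f p))

z₁Part-bilin : ∀ F p q → z₁Part (bilin F p q) ≈ bilin (λ u v → z₁Part (F u v)) p q
z₁Part-bilin F p q = begin
  z₁Part (bilin F p q)                        ≡⟨ cong z₁Part (bilin-lin F p q) ⟩
  z₁Part (lin (λ u → lin (F u) q) p)          ≡⟨ z₁Part-lin _ p ⟩
  lin (λ u → z₁Part (lin (F u) q)) p          ≈⟨ lin-congʳ p (λ u → ≈-reflexive (z₁Part-lin (F u) q)) ⟩
  lin (λ u → lin (λ v → z₁Part (F u v)) q) p  ≡⟨ bilin-lin _ p q ⟨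
  bilin (λ u v → z₁Part (F u v)) p q          ∎

z₁Part-cong : ∀ {p q} → p ≈ q → z₁Part p ≈ z₁Part q
z₁Part-cong {p} {q} p≈q = coeffwise λ w → by-cases w (z₁Free? w)
  where
  by-cases : ∀ w → Dec (Z₁Free w) → coeff (z₁Part p) w ≡ coeff (z₁Part q) w
  by-cases w (yes free) = trans (coeff-restrict-¬ _ p (λ ¬free → ¬free free))
                                (sym (coeff-restrict-¬ _ q (λ ¬free → ¬free free)))
  by-cases w (no ¬free) = trans (coeff-restrict _ p ¬free) (trans (coeff-≡ p≈q w) (sym (coeff-restrict _ q ¬free)))

z₁Free-z₁Part : ∀ {p} → All (Z₁Free ∘ proj₂) p → z₁Part p ≡ []
z₁Free-z₁Part = filter-none _ ∘ All.map (λ free ¬free → ¬free free)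

z₁Part-idem : ∀ {p} → All (¬_ ∘ Z₁Free ∘ proj₂) p → z₁Part p ≡ p
z₁Part-idem = filter-all _

z₁FreePart⊕z₁Part : ∀ p → p ≈ z₁FreePart p ⊕ z₁Part p
z₁FreePart⊕z₁Part p = coeffwise λ w → sym (trans (coeff-++ (z₁FreePart p) (z₁Part p) w) (by-cases w (z₁Free? w)))
  where
  by-cases : ∀ w → Dec (Z₁Free w) → coeff (z₁FreePart p) w + coeff (z₁Part p) w ≡ coeff p w
  by-cases w (yes free) = trans (cong₂ _+_ (coeff-restrict _ p free) (coeff-restrict-¬ _ p (λ ¬free → ¬free free)))
                                (ℚ.+-identityʳ _)
  by-cases w (no ¬free) = trans (cong₂ _+_ (coeff-restrict-¬ _ p ¬free) (coeff-restrict _ p ¬free))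
                                (ℚ.+-identityˡ _)

z₁Part-⊖ : ∀ p q → z₁Part (p ⊖ q) ≡ z₁Part p ⊖ z₁Part q
z₁Part-⊖ p q = trans (z₁Part-⊕ p (⊖ q)) (cong (z₁Part p ⊕_) (z₁Part-scale (- 1ℚ) q))

z₁Part≈[]⇒In𝔥≥2 : ∀ p → z₁Part p ≈ [] → In𝔥≥2 p
z₁Part≈[]⇒In𝔥≥2 p z₁p≈[] w coeff≢0 with z₁Free? w
... | yes free = free
... | no ¬free = contradiction (trans (sym (coeff-restrict _ p ¬free)) (coeff-≡ z₁p≈[] w)) coeff≢0

In𝔥≥2⇒z₁Part≈[] : ∀ p → In𝔥≥2 p → z₁Part p ≈ []
In𝔥≥2⇒z₁Part≈[] p p∈𝔥≥2 = coeffwise λ w → by-cases w (z₁Free? w)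
  where
  by-cases : ∀ w → Dec (Z₁Free w) → coeff (z₁Part p) w ≡ 0ℚ
  by-cases w (yes free) = coeff-restrict-¬ _ p (λ ¬free → ¬free free)
  by-cases w (no ¬free) = trans (coeff-restrict _ p ¬free)
    (decidable-stable (coeff p w ≟ 0ℚ) (λ coeff≢0 → ¬free (p∈𝔥≥2 w coeff≢0)))

z₁Free⇒In𝔥≥2 : ∀ {p} → All (Z₁Free ∘ proj₂) p → In𝔥≥2 p
z₁Free⇒In𝔥≥2 {p} frees = z₁Part≈[]⇒In𝔥≥2 p (≈-reflexive (z₁Free-z₁Part frees))

In𝔥≥2⇒≈z₁FreePart : ∀ p → In𝔥≥2 p → p ≈ z₁FreePart p
In𝔥≥2⇒≈z₁FreePart p p∈𝔥≥2 = begin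
  p                        ≈⟨ z₁FreePart⊕z₁Part p ⟩
  z₁FreePart p ⊕ z₁Part p  ≈⟨ ⊕-cong ≈-refl (In𝔥≥2⇒z₁Part≈[] p p∈𝔥≥2) ⟩
  z₁FreePart p ⊕ []        ≡⟨ ++-identityʳ _ ⟩
  z₁FreePart p             ∎

lin-congʳ-𝔥≥2 : ∀ {f g} p → In𝔥≥2 p → (∀ u → Z₁Free u → f u ≈ g u) → lin f p ≈ lin g p
lin-congʳ-𝔥≥2 {f} {g} p p∈𝔥≥2 f≈g = begin
  lin f p               ≈⟨ lin-congˡ f (In𝔥≥2⇒≈z₁FreePart p p∈𝔥≥2) ⟩
  lin f (z₁FreePart p)  ≈⟨ on-z₁Free (all-filter (z₁Free? ∘ proj₂) p) ⟩
  lin g (z₁FreePart p)  ≈⟨ lin-congˡ g (In𝔥≥2⇒≈z₁FreePart p p∈𝔥≥2) ⟨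
  lin g p               ∎
  where
  on-z₁Free : ∀ {q} → All (Z₁Free ∘ proj₂) q → lin f q ≈ lin g q
  on-z₁Free [] = ≈-refl
  on-z₁Free {(c , u) ∷ q} (free ∷ frees) = ⊕-cong (scale-cong c (f≈g u free)) (on-z₁Free frees)

bilin-congᶠ-𝔥≥2 : ∀ {F G} p q → In𝔥≥2 p → In𝔥≥2 q →
                  (∀ u v → Z₁Free u → Z₁Free v → F u v ≈ G u v) → bilin F p q ≈ bilin G p q
bilin-congᶠ-𝔥≥2 {F} {G} p q p∈𝔥≥2 q∈𝔥≥2 F≈G = begin
  bilin F p q                ≡⟨ bilin-lin F p q ⟩
  lin (λ u → lin (F u) q) p  ≈⟨ lin-congʳ-𝔥≥2 p p∈𝔥≥2 (λ u free → lin-congʳ-𝔥≥2 q q∈𝔥≥2 (λ v → F≈G u v free)) ⟩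
  lin (λ u → lin (G u) q) p  ≡⟨ bilin-lin G p q ⟨
  bilin G p q                ∎

prefix-z₁Free : ∀ {a p} → 1 ≤ a → All (Z₁Free ∘ proj₂) p → All (Z₁Free ∘ proj₂) (prefix a p)
prefix-z₁Free 1≤a frees = map⁺ (All.map (1≤a ∷_) frees)

harmW-z₁Free : ∀ {u v} → Z₁Free u → Z₁Free v → All (Z₁Free ∘ proj₂) (harmW u v)
harmW-z₁Free {[]} _ free-v = free-v ∷ []
harmW-z₁Free {_ ∷ _} {[]} free-u _ = free-u ∷ []
harmW-z₁Free {_ ∷ _} {_ ∷ _} free-u@(1≤a ∷ free-u′) free-v@(1≤b ∷ free-v′) =
  ++⁺ (prefix-z₁Free 1≤a (harmW-z₁Free free-u′ free-v))
  (++⁺ (prefix-z₁Free 1≤b (harmW-z₁Free free-u free-v′))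
       (prefix-z₁Free (s≤s z≤n) (harmW-z₁Free free-u′ free-v′)))

∗-In𝔥≥2 : ∀ p q → In𝔥≥2 p → In𝔥≥2 q → In𝔥≥2 (p ∗ q)
∗-In𝔥≥2 p q p∈𝔥≥2 q∈𝔥≥2 = z₁Part≈[]⇒In𝔥≥2 (p ∗ q) (begin
  z₁Part (p ∗ q)
    ≈⟨ z₁Part-bilin harmW p q ⟩
  bilin (λ u v → z₁Part (harmW u v)) p q
    ≈⟨ bilin-congᶠ-𝔥≥2 p q p∈𝔥≥2 q∈𝔥≥2 (λ u v fu fv → ≈-reflexive (z₁Free-z₁Part (harmW-z₁Free fu fv))) ⟩
  bilin (λ _ _ → []) p q
    ≡⟨ trans (bilin-lin _ p q) (lin-[]ᶠ p (λ _ → lin-[]ᶠ q (λ _ → refl))) ⟩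
  [] ∎)

z₁Part-∗-z₁Part : ∀ p q → In𝔥≥2 q → z₁Part (p ∗ q) ≈ z₁Part (z₁Part p ∗ q)
z₁Part-∗-z₁Part p q q∈𝔥≥2 = begin
  z₁Part (p ∗ q)
    ≈⟨ z₁Part-cong (bilin-cong harmW (z₁FreePart⊕z₁Part p) (≈-refl {q})) ⟩
  z₁Part ((z₁FreePart p ⊕ z₁Part p) ∗ q)
    ≡⟨ trans (cong z₁Part (bilin-⊕ˡ harmW (z₁FreePart p) (z₁Part p) q)) (z₁Part-⊕ (z₁FreePart p ∗ q) _) ⟩
  z₁Part (z₁FreePart p ∗ q) ⊕ z₁Part (z₁Part p ∗ q)
    ≈⟨ ⊕-cong (In𝔥≥2⇒z₁Part≈[] (z₁FreePart p ∗ q)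
                 (∗-In𝔥≥2 (z₁FreePart p) q (z₁Free⇒In𝔥≥2 (all-filter _ p)) q∈𝔥≥2)) ≈-refl ⟩
  z₁Part (z₁Part p ∗ q) ∎

z₂∈𝔥≥2 : In𝔥≥2 z₂
z₂∈𝔥≥2 = z₁Free⇒In𝔥≥2 ((s≤s z≤n ∷ []) ∷ [])

z₁Part-∗-⊕ˡ : ∀ p p′ q → z₁Part ((p ⊕ p′) ∗ q) ≡ z₁Part (p ∗ q) ⊕ z₁Part (p′ ∗ q)
z₁Part-∗-⊕ˡ p p′ q = trans (cong z₁Part (bilin-⊕ˡ harmW p p′ q)) (z₁Part-⊕ (p ∗ q) (p′ ∗ q))

z₁Part-∗-prefix : ∀ a b p q → z₁Part (prefix a p ∗ prefix (suc b) q) ≈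
  z₁Part (prefix a (p ∗ prefix (suc b) q)) ⊕ prefix (suc b) (z₁Part (prefix a p ∗ q))
    ⊕ prefix (suc (a +ℕ suc b)) (z₁Part (p ∗ q))
z₁Part-∗-prefix a b p q = begin
  z₁Part (prefix a p ∗ prefix (suc b) q)  ≈⟨ z₁Part-cong (∗-prefix a (suc b) p q) ⟩
  z₁Part (X ⊕ prefix (suc b) Y ⊕ prefix c Z)
    ≡⟨ trans (z₁Part-⊕ X _) (cong (z₁Part X ⊕_) (trans (z₁Part-⊕ (prefix (suc b) Y) (prefix c Z))
         (cong₂ _⊕_ (z₁Part-prefix-suc b Y) (z₁Part-prefix-suc (a +ℕ suc b) Z)))) ⟩
  z₁Part X ⊕ prefix (suc b) (z₁Part Y) ⊕ prefix c (z₁Part Z) ∎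
  where
  X = prefix a (p ∗ prefix (suc b) q)
  Y = prefix a p ∗ q
  Z = p ∗ q
  c = suc (a +ℕ suc b)

z₁Part-word-∗ : ∀ {u v} → Z₁Free u → Z₁Free v → z₁Part (word u ∗ word v) ≈ []
z₁Part-word-∗ {u} {v} free-u free-v = In𝔥≥2⇒z₁Part≈[] (word u ∗ word v)
  (∗-In𝔥≥2 (word u) (word v) (z₁Free⇒In𝔥≥2 (free-u ∷ [])) (z₁Free⇒In𝔥≥2 (free-v ∷ [])))

insZ₁ : Word → Poly
insZ₁ [] = word (0 ∷ [])
insZ₁ (a ∷ w) = word (0 ∷ a ∷ w) ⊕ prefix a (insZ₁ w)

prefix-¬z₁Free : ∀ {a p} → All (¬_ ∘ Z₁Free ∘ proj₂) p → All (¬_ ∘ Z₁Free ∘ proj₂) (prefix a p)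
prefix-¬z₁Free = map⁺ ∘ All.map (λ { ¬free (_ ∷ free) → ¬free free })

insZ₁-¬z₁Free : ∀ w → All (¬_ ∘ Z₁Free ∘ proj₂) (insZ₁ w)
insZ₁-¬z₁Free [] = (λ { (() ∷ _) }) ∷ []
insZ₁-¬z₁Free (a ∷ w) = (λ { (() ∷ _) }) ∷ prefix-¬z₁Free (insZ₁-¬z₁Free w)

lin-insZ₁-prefix : ∀ a p → lin insZ₁ (prefix a p) ≈ prefix 0 (prefix a p) ⊕ prefix a (lin insZ₁ p)
lin-insZ₁-prefix a p = begin
  lin insZ₁ (prefix a p)
    ≡⟨ lin-prefix insZ₁ a p ⟩
  lin (λ w → prefix 0 (prefix a (word w)) ⊕ prefix a (insZ₁ w)) p
    ≈⟨ lin-⊕ᶠ _ _ p ⟩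
  lin (λ w → prefix 0 (prefix a (word w))) p ⊕ lin (prefix a ∘ insZ₁) p
    ≡⟨ cong₂ _⊕_ (trans (lin-prefixᶠ 0 _ p) (cong (prefix 0) (lin-prefixᶠ a word p))) (lin-prefixᶠ a insZ₁ p) ⟩
  prefix 0 (prefix a (lin word p)) ⊕ prefix a (lin insZ₁ p)
    ≈⟨ ⊕-cong (prefix-cong 0 (prefix-cong a (lin-word-id p))) ≈-refl ⟩
  prefix 0 (prefix a p) ⊕ prefix a (lin insZ₁ p) ∎

lin-insZ₁-harmW : ∀ a b s t → lin insZ₁ (harmW (a ∷ s) (b ∷ t)) ≈
  prefix 0 (harmW (a ∷ s) (b ∷ t)) ⊕ prefix a (lin insZ₁ (harmW s (b ∷ t)))
    ⊕ prefix b (lin insZ₁ (harmW (a ∷ s) t)) ⊕ prefix (suc (a +ℕ b)) (lin insZ₁ (harmW s t))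
lin-insZ₁-harmW a b s t = begin
  lin insZ₁ (prefix a H₁ ⊕ prefix b H₂ ⊕ prefix c H₃)
    ≡⟨ trans (lin-++ insZ₁ (prefix a H₁) _) (cong (lin insZ₁ (prefix a H₁) ⊕_) (lin-++ insZ₁ (prefix b H₂) _)) ⟩
  lin insZ₁ (prefix a H₁) ⊕ lin insZ₁ (prefix b H₂) ⊕ lin insZ₁ (prefix c H₃)
    ≈⟨ ⊕-cong (lin-insZ₁-prefix a H₁) (⊕-cong (lin-insZ₁-prefix b H₂) (lin-insZ₁-prefix c H₃)) ⟩
  (prefix 0 (prefix a H₁) ⊕ prefix a (lin insZ₁ H₁)) ⊕ (prefix 0 (prefix b H₂) ⊕ prefix b (lin insZ₁ H₂))
    ⊕ (prefix 0 (prefix c H₃) ⊕ prefix c (lin insZ₁ H₃))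
    ≈⟨ ⊕-solve 6 (λ x₁ y₁ x₂ y₂ x₃ y₃ → (x₁ ⊞ y₁) ⊞ (x₂ ⊞ y₂) ⊞ (x₃ ⊞ y₃) ⊜ (x₁ ⊞ x₂ ⊞ x₃) ⊞ y₁ ⊞ y₂ ⊞ y₃) ≈-refl
         (prefix 0 (prefix a H₁)) (prefix a (lin insZ₁ H₁)) (prefix 0 (prefix b H₂)) (prefix b (lin insZ₁ H₂))
         (prefix 0 (prefix c H₃)) (prefix c (lin insZ₁ H₃)) ⟩
  (prefix 0 (prefix a H₁) ⊕ prefix 0 (prefix b H₂) ⊕ prefix 0 (prefix c H₃))
    ⊕ prefix a (lin insZ₁ H₁) ⊕ prefix b (lin insZ₁ H₂) ⊕ prefix c (lin insZ₁ H₃)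
    ≡⟨ cong (_⊕ prefix a (lin insZ₁ H₁) ⊕ prefix b (lin insZ₁ H₂) ⊕ prefix c (lin insZ₁ H₃))
            (trans (prefix-⊕ 0 (prefix a H₁) _) (cong (prefix 0 (prefix a H₁) ⊕_) (prefix-⊕ 0 (prefix b H₂) _))) ⟨
  prefix 0 (harmW (a ∷ s) (b ∷ t)) ⊕ prefix a (lin insZ₁ H₁) ⊕ prefix b (lin insZ₁ H₂) ⊕ prefix c (lin insZ₁ H₃) ∎
  where
  H₁ = harmW s (b ∷ t)
  H₂ = harmW (a ∷ s) t
  H₃ = harmW s t
  c = suc (a +ℕ b)

z₁Part-insZ₁-∗ : ∀ s t → Z₁Free s → Z₁Free t → z₁Part (insZ₁ s ∗ word t) ≈ lin insZ₁ (harmW s t)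
z₁Part-insZ₁-∗ s [] _ _ = begin
  z₁Part (insZ₁ s ∗ word [])  ≈⟨ z₁Part-cong (∗-identityʳ (insZ₁ s)) ⟩
  z₁Part (insZ₁ s)            ≡⟨ z₁Part-idem (insZ₁-¬z₁Free s) ⟩
  insZ₁ s                     ≈⟨ lin-word insZ₁ s ⟨
  lin insZ₁ (word s)          ≡⟨ cong (lin insZ₁) (harmW-[]ʳ s) ⟨
  lin insZ₁ (harmW s [])      ∎
z₁Part-insZ₁-∗ [] (suc b ∷ t) _ (_ ∷ free-t) = begin
  z₁Part (prefix 0 (word []) ∗ prefix (suc b) (word t))
    ≈⟨ z₁Part-∗-prefix 0 b (word []) (word t) ⟩
  z₁Part (prefix 0 (word [] ∗ word (suc b ∷ t))) ⊕ prefix (suc b) (z₁Part (insZ₁ [] ∗ word t))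
    ⊕ prefix (suc (suc b)) (z₁Part (word [] ∗ word t))
    ≈⟨ ⊕-cong (z₁Part-prefix-0-≈ (bilin-word harmW [] (suc b ∷ t)))
         (⊕-cong (prefix-cong (suc b) (≈-trans (z₁Part-insZ₁-∗ [] t [] free-t) (lin-word insZ₁ t)))
                 (prefix-cong (suc (suc b)) (z₁Part-word-∗ [] free-t))) ⟩
  word (0 ∷ suc b ∷ t) ⊕ prefix (suc b) (insZ₁ t) ⊕ []
    ≡⟨ cong (word (0 ∷ suc b ∷ t) ⊕_) (++-identityʳ _) ⟩
  insZ₁ (suc b ∷ t)            ≈⟨ lin-word insZ₁ (suc b ∷ t) ⟨
  lin insZ₁ (word (suc b ∷ t)) ∎
z₁Part-insZ₁-∗ [] (zero ∷ t) _ (() ∷ _)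
z₁Part-insZ₁-∗ (zero ∷ s) (_ ∷ t) (() ∷ _) _
z₁Part-insZ₁-∗ (suc a ∷ s) (zero ∷ t) _ (() ∷ _)
z₁Part-insZ₁-∗ (suc a ∷ s) (suc b ∷ t) free-s₀@(_ ∷ free-s) free-t₀@(_ ∷ free-t) = begin
  z₁Part ((prefix 0 (word s₀) ⊕ prefix A (insZ₁ s)) ∗ prefix B (word t))
    ≡⟨ z₁Part-∗-⊕ˡ (prefix 0 (word s₀)) (prefix A (insZ₁ s)) (prefix B (word t)) ⟩
  z₁Part (prefix 0 (word s₀) ∗ prefix B (word t)) ⊕ z₁Part (prefix A (insZ₁ s) ∗ prefix B (word t))
    ≈⟨ ⊕-cong (z₁Part-∗-prefix 0 b (word s₀) (word t)) (z₁Part-∗-prefix A b (insZ₁ s) (word t)) ⟩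
  (z₁Part (prefix 0 (word s₀ ∗ word t₀)) ⊕ prefix B X ⊕ prefix (suc B) (z₁Part (word s₀ ∗ word t)))
    ⊕ (z₁Part (prefix A (insZ₁ s ∗ word t₀)) ⊕ prefix B Y ⊕ prefix C (z₁Part (insZ₁ s ∗ word t)))
    ≈⟨ ⊕-cong (⊕-cong (z₁Part-prefix-0-≈ (bilin-word harmW s₀ t₀))
                      (⊕-cong ≈-refl (prefix-cong (suc B) (z₁Part-word-∗ free-s₀ free-t))))
              (⊕-cong (z₁Part-prefix-suc-≈ a (insZ₁ s ∗ word t₀) (z₁Part-insZ₁-∗ s t₀ free-s free-t₀))
                      (⊕-cong ≈-refl (prefix-cong C (z₁Part-insZ₁-∗ s t free-s free-t)))) ⟩
  (prefix 0 (harmW s₀ t₀) ⊕ prefix B X ⊕ []) ⊕ (prefix A (lin insZ₁ H₁) ⊕ prefix B Y ⊕ prefix C (lin insZ₁ H₃))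
    ≈⟨ ⊕-solve 5 (λ h x₁ y x₃ z → (h ⊞ x₁ ⊞ id) ⊞ (y ⊞ x₃ ⊞ z) ⊜ h ⊞ y ⊞ (x₁ ⊞ x₃) ⊞ z) ≈-refl
         (prefix 0 (harmW s₀ t₀)) (prefix B X) (prefix A (lin insZ₁ H₁)) (prefix B Y) (prefix C (lin insZ₁ H₃)) ⟩
  prefix 0 (harmW s₀ t₀) ⊕ prefix A (lin insZ₁ H₁) ⊕ (prefix B X ⊕ prefix B Y) ⊕ prefix C (lin insZ₁ H₃)
    ≡⟨ cong (λ z → prefix 0 (harmW s₀ t₀) ⊕ prefix A (lin insZ₁ H₁) ⊕ z ⊕ prefix C (lin insZ₁ H₃)) (prefix-⊕ B X Y) ⟨
  prefix 0 (harmW s₀ t₀) ⊕ prefix A (lin insZ₁ H₁) ⊕ prefix B (X ⊕ Y) ⊕ prefix C (lin insZ₁ H₃)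
    ≈⟨ ⊕-cong (≈-refl {prefix 0 (harmW s₀ t₀)}) (⊕-cong (≈-refl {prefix A (lin insZ₁ H₁)})
         (⊕-cong (prefix-cong B X⊕Y≈) (≈-refl {prefix C (lin insZ₁ H₃)}))) ⟩
  prefix 0 (harmW s₀ t₀) ⊕ prefix A (lin insZ₁ H₁) ⊕ prefix B (lin insZ₁ H₂) ⊕ prefix C (lin insZ₁ H₃)
    ≈⟨ lin-insZ₁-harmW A B s t ⟨
  lin insZ₁ (harmW s₀ t₀) ∎
  where
  A = suc a
  B = suc b
  C = suc (A +ℕ B)
  s₀ = A ∷ s
  t₀ = B ∷ t
  H₁ = harmW s t₀
  H₂ = harmW s₀ t
  H₃ = harmW s t
  X = z₁Part (prefix 0 (word s₀) ∗ word t)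
  Y = z₁Part (prefix A (insZ₁ s) ∗ word t)
  X⊕Y≈ : X ⊕ Y ≈ lin insZ₁ H₂
  X⊕Y≈ = ≈-trans (≈-reflexive (sym (z₁Part-∗-⊕ˡ (prefix 0 (word s₀)) (prefix A (insZ₁ s)) (word t))))
                 (z₁Part-insZ₁-∗ s₀ t free-s₀ free-t)

-- Half the z₁-part of w ⧢ z₂ (see z₁Part-z₂Shuffle-0). With letters written as z_k,
-- δ(z_k w) = k z_{k+1} insZ₁(w) + z_k δ(w).
δ : Word → Poly
δ [] = []
δ (a ∷ w) = scale (suc a × 1ℚ) (prefix (suc a) (insZ₁ w)) ⊕ prefix a (δ w)

δ-¬z₁Free : ∀ w → All (¬_ ∘ Z₁Free ∘ proj₂) (δ w)
δ-¬z₁Free [] = []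
δ-¬z₁Free (a ∷ w) = ++⁺ (map⁺ (prefix-¬z₁Free (insZ₁-¬z₁Free w))) (prefix-¬z₁Free (δ-¬z₁Free w))

lin-δ-prefix : ∀ a p → lin δ (prefix a p) ≈ scale (suc a × 1ℚ) (prefix (suc a) (lin insZ₁ p)) ⊕ prefix a (lin δ p)
lin-δ-prefix a p = begin
  lin δ (prefix a p)
    ≡⟨ lin-prefix δ a p ⟩
  lin (λ w → scale k (prefix (suc a) (insZ₁ w)) ⊕ prefix a (δ w)) p
    ≈⟨ lin-⊕ᶠ _ _ p ⟩
  lin (λ w → scale k (prefix (suc a) (insZ₁ w))) p ⊕ lin (prefix a ∘ δ) p
    ≈⟨ ⊕-cong (lin-scaleᶠ k _ p) ≈-refl ⟩
  scale k (lin (prefix (suc a) ∘ insZ₁) p) ⊕ lin (prefix a ∘ δ) p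
    ≡⟨ cong₂ _⊕_ (cong (scale k) (lin-prefixᶠ (suc a) insZ₁ p)) (lin-prefixᶠ a δ p) ⟩
  scale k (prefix (suc a) (lin insZ₁ p)) ⊕ prefix a (lin δ p) ∎
  where k = suc a × 1ℚ

z₁Part-δ-∗ : ∀ a s q → z₁Part (δ (a ∷ s) ∗ q) ≈
  scale (suc a × 1ℚ) (z₁Part (prefix (suc a) (insZ₁ s) ∗ q)) ⊕ z₁Part (prefix a (δ s) ∗ q)
z₁Part-δ-∗ a s q = begin
  z₁Part (δ (a ∷ s) ∗ q)
    ≡⟨ z₁Part-∗-⊕ˡ (scale k (prefix (suc a) (insZ₁ s))) (prefix a (δ s)) q ⟩
  z₁Part (scale k (prefix (suc a) (insZ₁ s)) ∗ q) ⊕ z₁Part (prefix a (δ s) ∗ q)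
    ≈⟨ ⊕-cong (≈-trans (z₁Part-cong (bilin-scaleˡ harmW k P q)) (≈-reflexive (z₁Part-scale k (P ∗ q)))) ≈-refl ⟩
  scale k (z₁Part (prefix (suc a) (insZ₁ s) ∗ q)) ⊕ z₁Part (prefix a (δ s) ∗ q) ∎
  where
  k = suc a × 1ℚ
  P = prefix (suc a) (insZ₁ s)

z₁Part-δ-∗-step : ∀ a b s t → Z₁Free s → Z₁Free t →
  z₁Part (δ (suc a ∷ s) ∗ word (suc b ∷ t)) ≈
    scale (suc (suc a) × 1ℚ) (prefix (suc (suc a)) (lin insZ₁ (harmW s (suc b ∷ t)))
                               ⊕ prefix (suc (suc (suc a +ℕ suc b))) (lin insZ₁ (harmW s t)))
    ⊕ prefix (suc a) (z₁Part (δ s ∗ word (suc b ∷ t)))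
    ⊕ prefix (suc b) (z₁Part (δ (suc a ∷ s) ∗ word t))
    ⊕ prefix (suc (suc a +ℕ suc b)) (z₁Part (δ s ∗ word t))
z₁Part-δ-∗-step a b s t free-s free-t = begin
  z₁Part (δ (A ∷ s) ∗ word t₀)
    ≈⟨ z₁Part-δ-∗ A s (word t₀) ⟩
  scale k (z₁Part (prefix (suc A) (insZ₁ s) ∗ prefix B (word t))) ⊕ z₁Part (prefix A (δ s) ∗ prefix B (word t))
    ≈⟨ ⊕-cong (scale-cong k (z₁Part-∗-prefix (suc A) b (insZ₁ s) (word t))) (z₁Part-∗-prefix A b (δ s) (word t)) ⟩
  scale k (z₁Part (prefix (suc A) (insZ₁ s ∗ word t₀)) ⊕ prefix B X ⊕ prefix (suc C) (z₁Part (insZ₁ s ∗ word t)))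
    ⊕ (z₁Part (prefix A (δ s ∗ word t₀)) ⊕ prefix B Y ⊕ L₃)
    ≈⟨ ⊕-cong (scale-cong k (⊕-cong (z₁Part-prefix-suc-≈ A (insZ₁ s ∗ word t₀) (z₁Part-insZ₁-∗ s t₀ free-s free-t₀))
                                     (⊕-cong (≈-refl {prefix B X}) (prefix-cong (suc C) (z₁Part-insZ₁-∗ s t free-s free-t)))))
              (⊕-cong (≈-reflexive (z₁Part-prefix-suc a (δ s ∗ word t₀))) (≈-refl {prefix B Y ⊕ L₃})) ⟩
  scale k (I₁ ⊕ prefix B X ⊕ I₃) ⊕ (L₁ ⊕ prefix B Y ⊕ L₃)
    ≡⟨ cong (_⊕ L₁ ⊕ prefix B Y ⊕ L₃) (trans (scale-⊕ k I₁ _) (cong (scale k I₁ ⊕_)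
         (trans (scale-⊕ k (prefix B X) I₃) (cong (_⊕ scale k I₃) (sym (prefix-scale B k X)))))) ⟩
  (scale k I₁ ⊕ prefix B (scale k X) ⊕ scale k I₃) ⊕ (L₁ ⊕ prefix B Y ⊕ L₃)
    ≈⟨ ⊕-solve 6 (λ i₁ x i₃ l₁ y l₃ → (i₁ ⊞ x ⊞ i₃) ⊞ (l₁ ⊞ y ⊞ l₃) ⊜ (i₁ ⊞ i₃) ⊞ l₁ ⊞ (x ⊞ y) ⊞ l₃) ≈-refl
         (scale k I₁) (prefix B (scale k X)) (scale k I₃) L₁ (prefix B Y) L₃ ⟩
  (scale k I₁ ⊕ scale k I₃) ⊕ L₁ ⊕ (prefix B (scale k X) ⊕ prefix B Y) ⊕ L₃
    ≡⟨ cong₂ (λ u v → u ⊕ L₁ ⊕ v ⊕ L₃) (scale-⊕ k I₁ I₃) (prefix-⊕ B (scale k X) Y) ⟨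
  scale k (I₁ ⊕ I₃) ⊕ L₁ ⊕ prefix B (scale k X ⊕ Y) ⊕ L₃
    ≈⟨ ⊕-cong (≈-refl {scale k (I₁ ⊕ I₃)}) (⊕-cong (≈-refl {L₁})
         (⊕-cong (prefix-cong B (z₁Part-δ-∗ A s (word t))) (≈-refl {L₃}))) ⟨
  scale k (I₁ ⊕ I₃) ⊕ L₁ ⊕ prefix B (z₁Part (δ (A ∷ s) ∗ word t)) ⊕ L₃ ∎
  where
  A = suc a
  B = suc b
  C = suc (A +ℕ B)
  k = suc A × 1ℚ
  t₀ = B ∷ t
  free-t₀ : Z₁Free t₀
  free-t₀ = s≤s z≤n ∷ free-t
  X = z₁Part (prefix (suc A) (insZ₁ s) ∗ word t)
  Y = z₁Part (prefix A (δ s) ∗ word t)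
  I₁ = prefix (suc A) (lin insZ₁ (harmW s t₀))
  I₃ = prefix (suc C) (lin insZ₁ (harmW s t))
  L₁ = prefix A (z₁Part (δ s ∗ word t₀))
  L₃ = prefix C (z₁Part (δ s ∗ word t))

weight-+ : ∀ a b → suc (suc (a +ℕ b)) × 1ℚ ≡ suc a × 1ℚ + suc b × 1ℚ
weight-+ a b = trans (cong (λ n → suc n × 1ℚ) (sym (+-suc a b))) (×-homo-+ 1ℚ (suc a) (suc b))

lin-δ-harmW-∷ : ∀ a b s t → lin δ (harmW (a ∷ s) (b ∷ t)) ≈
  (scale (suc a × 1ℚ) (prefix (suc a) (lin insZ₁ (harmW s (b ∷ t)))) ⊕ prefix a (lin δ (harmW s (b ∷ t))))
  ⊕ (scale (suc b × 1ℚ) (prefix (suc b) (lin insZ₁ (harmW (a ∷ s) t))) ⊕ prefix b (lin δ (harmW (a ∷ s) t)))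
  ⊕ (scale (suc (suc (a +ℕ b)) × 1ℚ) (prefix (suc (suc (a +ℕ b))) (lin insZ₁ (harmW s t)))
     ⊕ prefix (suc (a +ℕ b)) (lin δ (harmW s t)))
lin-δ-harmW-∷ a b s t =
  ≈-trans (≈-reflexive (trans (lin-++ δ (prefix a H₁) _) (cong (lin δ (prefix a H₁) ⊕_) (lin-++ δ (prefix b H₂) _))))
          (⊕-cong (lin-δ-prefix a H₁) (⊕-cong (lin-δ-prefix b H₂) (lin-δ-prefix _ H₃)))
  where
  H₁ = harmW s (b ∷ t)
  H₂ = harmW (a ∷ s) t
  H₃ = harmW s t

z₁Part-δ-∗-[] : ∀ s → z₁Part (δ s ∗ word []) ≈ δ s
z₁Part-δ-∗-[] s = ≈-trans (z₁Part-cong (∗-identityʳ (δ s))) (≈-reflexive (z₁Part-idem (δ-¬z₁Free s)))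

lin-δ-harmW : ∀ s t → Z₁Free s → Z₁Free t → lin δ (harmW s t) ≈ z₁Part (δ s ∗ word t) ⊕ z₁Part (δ t ∗ word s)
lin-δ-harmW [] t _ _ = ≈-trans (lin-word δ t) (≈-sym (z₁Part-δ-∗-[] t))
lin-δ-harmW s@(_ ∷ _) [] _ _ =
  ≈-trans (lin-word δ s) (≈-sym (≈-trans (≈-reflexive (++-identityʳ _)) (z₁Part-δ-∗-[] s)))
lin-δ-harmW (zero ∷ s) (_ ∷ t) (() ∷ _) _
lin-δ-harmW (suc a ∷ s) (zero ∷ t) _ (() ∷ _)
-- Both sides are sums of the terms below: the induction hypotheses cover the three summands of harmW,
-- and the weight of the last insertion term splits as (A + 1) + (B + 1) (weight-+).
lin-δ-harmW (suc a ∷ s) (suc b ∷ t) free-s₀@(_ ∷ free-s) free-t₀@(_ ∷ free-t) = begin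
  lin δ (harmW s₀ t₀)
    ≈⟨ lin-δ-harmW-∷ A B s t ⟩
  (scale kA i₁ ⊕ prefix A (lin δ H₁)) ⊕ (scale kB i₂ ⊕ prefix B (lin δ H₂)) ⊕ (scale kC i₃ ⊕ prefix C (lin δ H₃))
    ≈⟨ ⊕-cong (⊕-cong (≈-refl {scale kA i₁}) (prefix-cong A (lin-δ-harmW s t₀ free-s free-t₀)))
      (⊕-cong (⊕-cong (≈-refl {scale kB i₂}) (prefix-cong B (lin-δ-harmW s₀ t free-s₀ free-t)))
              (⊕-cong (≈-trans (≈-reflexive (cong (λ k → scale k i₃) (weight-+ A B))) (scale-+ kA kB i₃))
                      (prefix-cong C (lin-δ-harmW s t free-s free-t)))) ⟩
  (scale kA i₁ ⊕ prefix A (ℓ₁ ⊕ ℓ₁′)) ⊕ (scale kB i₂ ⊕ prefix B (ℓ₂ ⊕ ℓ₂′))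
    ⊕ ((scale kA i₃ ⊕ scale kB i₃) ⊕ prefix C (ℓ₃ ⊕ ℓ₃′))
    ≡⟨ cong₂ _⊕_ (cong (scale kA i₁ ⊕_) (prefix-⊕ A ℓ₁ ℓ₁′)) (cong₂ _⊕_ (cong (scale kB i₂ ⊕_) (prefix-⊕ B ℓ₂ ℓ₂′))
         (cong ((scale kA i₃ ⊕ scale kB i₃) ⊕_) (prefix-⊕ C ℓ₃ ℓ₃′))) ⟩
  (scale kA i₁ ⊕ prefix A ℓ₁ ⊕ prefix A ℓ₁′) ⊕ (scale kB i₂ ⊕ prefix B ℓ₂ ⊕ prefix B ℓ₂′)
    ⊕ ((scale kA i₃ ⊕ scale kB i₃) ⊕ prefix C ℓ₃ ⊕ prefix C ℓ₃′)
    ≈⟨ ⊕-solve 10 (λ x₁ y₁ y₁′ x₂ y₂ y₂′ x₃ x₃′ y₃ y₃′ →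
           (x₁ ⊞ y₁ ⊞ y₁′) ⊞ (x₂ ⊞ y₂ ⊞ y₂′) ⊞ ((x₃ ⊞ x₃′) ⊞ y₃ ⊞ y₃′)
         ⊜ ((x₁ ⊞ x₃) ⊞ y₁ ⊞ y₂ ⊞ y₃) ⊞ ((x₂ ⊞ x₃′) ⊞ y₂′ ⊞ y₁′ ⊞ y₃′)) ≈-refl
         (scale kA i₁) (prefix A ℓ₁) (prefix A ℓ₁′) (scale kB i₂) (prefix B ℓ₂) (prefix B ℓ₂′)
         (scale kA i₃) (scale kB i₃) (prefix C ℓ₃) (prefix C ℓ₃′) ⟩
  ((scale kA i₁ ⊕ scale kA i₃) ⊕ prefix A ℓ₁ ⊕ prefix B ℓ₂ ⊕ prefix C ℓ₃)
    ⊕ ((scale kB i₂ ⊕ scale kB i₃) ⊕ prefix B ℓ₂′ ⊕ prefix A ℓ₁′ ⊕ prefix C ℓ₃′)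
    ≡⟨ cong₂ (λ x y → (x ⊕ prefix A ℓ₁ ⊕ prefix B ℓ₂ ⊕ prefix C ℓ₃) ⊕ (y ⊕ prefix B ℓ₂′ ⊕ prefix A ℓ₁′ ⊕ prefix C ℓ₃′))
         (scale-⊕ kA i₁ i₃) (scale-⊕ kB i₂ i₃) ⟨
  (scale kA (i₁ ⊕ i₃) ⊕ prefix A ℓ₁ ⊕ prefix B ℓ₂ ⊕ prefix C ℓ₃)
    ⊕ (scale kB (i₂ ⊕ i₃) ⊕ prefix B ℓ₂′ ⊕ prefix A ℓ₁′ ⊕ prefix C ℓ₃′)
    ≈⟨ ⊕-cong (z₁Part-δ-∗-step a b s t free-s free-t) swapped-step ⟨
  z₁Part (δ s₀ ∗ word t₀) ⊕ z₁Part (δ t₀ ∗ word s₀) ∎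
  where
  A = suc a
  B = suc b
  C = suc (A +ℕ B)
  kA = suc A × 1ℚ
  kB = suc B × 1ℚ
  kC = suc C × 1ℚ
  s₀ = A ∷ s
  t₀ = B ∷ t
  H₁ = harmW s t₀
  H₂ = harmW s₀ t
  H₃ = harmW s t
  i₁ = prefix (suc A) (lin insZ₁ H₁)
  i₂ = prefix (suc B) (lin insZ₁ H₂)
  i₃ = prefix (suc C) (lin insZ₁ H₃)
  ℓ₁ = z₁Part (δ s ∗ word t₀)
  ℓ₁′ = z₁Part (δ t₀ ∗ word s)
  ℓ₂ = z₁Part (δ s₀ ∗ word t)
  ℓ₂′ = z₁Part (δ t ∗ word s₀)
  ℓ₃ = z₁Part (δ s ∗ word t)
  ℓ₃′ = z₁Part (δ t ∗ word s)
  swapped-step : z₁Part (δ t₀ ∗ word s₀) ≈ scale kB (i₂ ⊕ i₃) ⊕ prefix B ℓ₂′ ⊕ prefix A ℓ₁′ ⊕ prefix C ℓ₃′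
  swapped-step = begin
    z₁Part (δ t₀ ∗ word s₀)
      ≈⟨ z₁Part-δ-∗-step b a t s free-t free-s ⟩
    scale kB (prefix (suc B) (lin insZ₁ (harmW t s₀)) ⊕ prefix (suc C′) (lin insZ₁ (harmW t s)))
      ⊕ prefix B ℓ₂′ ⊕ prefix A ℓ₁′ ⊕ prefix C′ ℓ₃′
      ≡⟨ cong (λ n → scale kB (prefix (suc B) (lin insZ₁ (harmW t s₀)) ⊕ prefix (suc (suc n)) (lin insZ₁ (harmW t s)))
                       ⊕ prefix B ℓ₂′ ⊕ prefix A ℓ₁′ ⊕ prefix (suc n) ℓ₃′) (+-comm B A) ⟩
    scale kB (prefix (suc B) (lin insZ₁ (harmW t s₀)) ⊕ prefix (suc C) (lin insZ₁ (harmW t s)))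
      ⊕ prefix B ℓ₂′ ⊕ prefix A ℓ₁′ ⊕ prefix C ℓ₃′
      ≈⟨ ⊕-cong (scale-cong kB (⊕-cong (prefix-cong (suc B) (lin-congˡ insZ₁ (harmW-comm t s₀)))
                                        (prefix-cong (suc C) (lin-congˡ insZ₁ (harmW-comm t s)))))
                (≈-refl {prefix B ℓ₂′ ⊕ prefix A ℓ₁′ ⊕ prefix C ℓ₃′}) ⟩
    scale kB (i₂ ⊕ i₃) ⊕ prefix B ℓ₂′ ⊕ prefix A ℓ₁′ ⊕ prefix C ℓ₃′ ∎
    where C′ = suc (B +ℕ A)

lin-δ-∗ : ∀ p q → In𝔥≥2 p → In𝔥≥2 q → lin δ (p ∗ q) ≈ z₁Part (lin δ p ∗ q) ⊕ z₁Part (lin δ q ∗ p)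
lin-δ-∗ p q p∈𝔥≥2 q∈𝔥≥2 = begin
  lin δ (p ∗ q)
    ≈⟨ lin-bilin δ harmW p q ⟩
  bilin (λ u v → lin δ (harmW u v)) p q
    ≈⟨ bilin-congᶠ-𝔥≥2 p q p∈𝔥≥2 q∈𝔥≥2 lin-δ-harmW ⟩
  bilin (λ u v → z₁Part (δ u ∗ word v) ⊕ z₁Part (δ v ∗ word u)) p q
    ≈⟨ bilin-⊕ᶠ _ _ p q ⟩
  bilin (λ u v → z₁Part (δ u ∗ word v)) p q ⊕ bilin (λ u v → z₁Part (δ v ∗ word u)) p q
    ≈⟨ ⊕-cong (≈-refl {bilin (λ u v → z₁Part (δ u ∗ word v)) p q}) (bilin-swap _ p q) ⟩
  bilin (λ u v → z₁Part (δ u ∗ word v)) p q ⊕ bilin (λ u v → z₁Part (δ u ∗ word v)) q p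
    ≈⟨ ⊕-cong (z₁Part-lin-∗ p q) (z₁Part-lin-∗ q p) ⟨
  z₁Part (lin δ p ∗ q) ⊕ z₁Part (lin δ q ∗ p) ∎
  where
  z₁Part-lin-∗ : ∀ p q → z₁Part (lin δ p ∗ q) ≈ bilin (λ u v → z₁Part (δ u ∗ word v)) p q
  z₁Part-lin-∗ p q = ≈-trans (z₁Part-cong (lin-∗ δ p q)) (z₁Part-bilin _ p q)

-- The z₁-part of w ⧢ z₂

-- fromXY is `go 0` for a reader `go n` local to Defs that carries n pending letters x.
-- Abstracting the literal 0 in the equation below lets unification name `go`.
readXY : ℕ → List XY → Word
readXY = read
  where
  read : ℕ → List XY → Word
  read = _
  read-0 : read 0 ≡ fromXY
  read-0 with 0
  ... | _ = refl

readXY-toXY : ∀ k n w → readXY k (toXY (n ∷ w)) ≡ (k +ℕ n) ∷ fromXY (toXY w)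
readXY-toXY k zero w = cong (_∷ fromXY (toXY w)) (sym (+-identityʳ k))
readXY-toXY k (suc n) w = trans (readXY-toXY (suc k) n w) (cong (_∷ fromXY (toXY w)) (sym (+-suc k n)))

fromXY-toXY : ∀ w → fromXY (toXY w) ≡ w
fromXY-toXY [] = refl
fromXY-toXY (n ∷ w) = trans (readXY-toXY 0 n w) (cong (n ∷_) (fromXY-toXY w))

readXYs : ℕ → List (List XY) → Poly
readXYs k = map (λ r → 1ℚ , readXY k r)

readXYs-x : ∀ k L → readXYs k (map (x ∷_) L) ≡ readXYs (suc k) L
readXYs-x k [] = refl
readXYs-x k (r ∷ L) = cong (_ ∷_) (readXYs-x k L)

readXYs-y : ∀ k L → readXYs k (map (y ∷_) L) ≡ prefix k (readXYs 0 L)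
readXYs-y k [] = refl
readXYs-y k (r ∷ L) = cong (_ ∷_) (readXYs-y k L)

-- w ⧢ z₁ and w ⧢ z₂ computed in {x, y}*, read back into letters z_k with k letters x pending.
yShuffle : ℕ → Word → Poly
yShuffle k w = readXYs k (shXY (toXY w) (y ∷ []))

z₂Shuffle : ℕ → Word → Poly
z₂Shuffle k w = readXYs k (shXY (toXY w) (x ∷ y ∷ []))

yShuffle-suc : ∀ k m w → yShuffle k (suc m ∷ w) ≡ yShuffle (suc k) (m ∷ w) ⊕ word (k ∷ suc m ∷ w)
yShuffle-suc k m w =
  trans (map-++ _ (map (x ∷_) (shXY (toXY (m ∷ w)) (y ∷ []))) ((y ∷ x ∷ toXY (m ∷ w)) ∷ []))
        (cong₂ _⊕_ (readXYs-x k (shXY (toXY (m ∷ w)) (y ∷ []))) (cong (λ v → (1ℚ , k ∷ v) ∷ []) (fromXY-toXY (suc m ∷ w))))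

yShuffle-zero : ∀ k w → yShuffle k (0 ∷ w) ≡ prefix k (yShuffle 0 w) ⊕ word (k ∷ 0 ∷ w)
yShuffle-zero k w =
  trans (map-++ _ (map (y ∷_) (shXY (toXY w) (y ∷ []))) ((y ∷ y ∷ toXY w) ∷ []))
        (cong₂ _⊕_ (readXYs-y k (shXY (toXY w) (y ∷ []))) (cong (λ v → (1ℚ , k ∷ 0 ∷ v) ∷ []) (fromXY-toXY w)))

z₂Shuffle-suc : ∀ k m w → z₂Shuffle k (suc m ∷ w) ≡ z₂Shuffle (suc k) (m ∷ w) ⊕ yShuffle (suc k) (suc m ∷ w)
z₂Shuffle-suc k m w =
  trans (map-++ _ (map (x ∷_) (shXY (toXY (m ∷ w)) (x ∷ y ∷ []))) (map (x ∷_) (shXY (toXY (suc m ∷ w)) (y ∷ []))))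
        (cong₂ _⊕_ (readXYs-x k (shXY (toXY (m ∷ w)) (x ∷ y ∷ []))) (readXYs-x k (shXY (toXY (suc m ∷ w)) (y ∷ []))))

z₂Shuffle-zero : ∀ k w → z₂Shuffle k (0 ∷ w) ≡ prefix k (z₂Shuffle 0 w) ⊕ yShuffle (suc k) (0 ∷ w)
z₂Shuffle-zero k w =
  trans (map-++ _ (map (y ∷_) (shXY (toXY w) (x ∷ y ∷ []))) (map (x ∷_) (shXY (toXY (0 ∷ w)) (y ∷ []))))
        (cong₂ _⊕_ (readXYs-y k (shXY (toXY w) (x ∷ y ∷ []))) (readXYs-x k (shXY (toXY (0 ∷ w)) (y ∷ []))))

z₁Part-yShuffle-0 : ∀ w → Z₁Free w → z₁Part (yShuffle 0 w) ⊕ word (0 ∷ w) ≈ insZ₁ w ⊕ insZ₁ w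
z₁Part-yShuffle : ∀ k n w → Z₁Free w → z₁Part (yShuffle (suc k) (n ∷ w)) ≈ prefix (suc k +ℕ n) (insZ₁ w ⊕ insZ₁ w)

z₁Part-yShuffle-0 [] _ = ≈-refl
z₁Part-yShuffle-0 (zero ∷ w) (() ∷ _)
z₁Part-yShuffle-0 (suc m ∷ w) (_ ∷ free) = begin
  z₁Part (yShuffle 0 (suc m ∷ w)) ⊕ W
    ≡⟨ cong (_⊕ W) (trans (cong z₁Part (yShuffle-suc 0 m w)) (z₁Part-⊕ (yShuffle 1 (m ∷ w)) W)) ⟩
  (z₁Part (yShuffle 1 (m ∷ w)) ⊕ z₁Part W) ⊕ W
    ≈⟨ ⊕-cong (⊕-cong (z₁Part-yShuffle 0 m w free) (≈-reflexive (z₁Part-idem ((λ { (() ∷ _) }) ∷ [])))) (≈-refl {W}) ⟩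
  (prefix (suc m) (insZ₁ w ⊕ insZ₁ w) ⊕ W) ⊕ W
    ≡⟨ cong (λ z → (z ⊕ W) ⊕ W) (prefix-⊕ (suc m) (insZ₁ w) (insZ₁ w)) ⟩
  ((P ⊕ P) ⊕ W) ⊕ W
    ≈⟨ ⊕-solve 2 (λ p w → ((p ⊞ p) ⊞ w) ⊞ w ⊜ (w ⊞ p) ⊞ (w ⊞ p)) ≈-refl P W ⟩
  insZ₁ (suc m ∷ w) ⊕ insZ₁ (suc m ∷ w) ∎
  where
  W = word (0 ∷ suc m ∷ w)
  P = prefix (suc m) (insZ₁ w)

z₁Part-yShuffle k zero w free = begin
  z₁Part (yShuffle (suc k) (0 ∷ w))
    ≡⟨ trans (cong z₁Part (yShuffle-zero (suc k) w))
       (trans (z₁Part-⊕ (prefix (suc k) (yShuffle 0 w)) (word (suc k ∷ 0 ∷ w)))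
              (cong₂ _⊕_ (z₁Part-prefix-suc k (yShuffle 0 w)) (z₁Part-idem ((λ { (_ ∷ () ∷ _) }) ∷ [])))) ⟩
  prefix (suc k) (z₁Part (yShuffle 0 w)) ⊕ word (suc k ∷ 0 ∷ w)
    ≡⟨ prefix-⊕ (suc k) (z₁Part (yShuffle 0 w)) (word (0 ∷ w)) ⟨
  prefix (suc k) (z₁Part (yShuffle 0 w) ⊕ word (0 ∷ w))
    ≈⟨ prefix-cong (suc k) (z₁Part-yShuffle-0 w free) ⟩
  prefix (suc k) (insZ₁ w ⊕ insZ₁ w)
    ≡⟨ cong (λ j → prefix j (insZ₁ w ⊕ insZ₁ w)) (+-identityʳ (suc k)) ⟨
  prefix (suc k +ℕ 0) (insZ₁ w ⊕ insZ₁ w) ∎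
z₁Part-yShuffle k (suc m) w free = begin
  z₁Part (yShuffle (suc k) (suc m ∷ w))
    ≡⟨ trans (cong z₁Part (yShuffle-suc (suc k) m w))
             (z₁Part-⊕ (yShuffle (suc (suc k)) (m ∷ w)) (word (suc k ∷ suc m ∷ w))) ⟩
  z₁Part (yShuffle (suc (suc k)) (m ∷ w)) ⊕ z₁Part (word (suc k ∷ suc m ∷ w))
    ≈⟨ ⊕-cong (z₁Part-yShuffle (suc k) m w free) (≈-reflexive (z₁Free-z₁Part ((s≤s z≤n ∷ s≤s z≤n ∷ free) ∷ []))) ⟩
  prefix (suc (suc k) +ℕ m) (insZ₁ w ⊕ insZ₁ w) ⊕ []
    ≡⟨ trans (++-identityʳ _) (cong (λ j → prefix j (insZ₁ w ⊕ insZ₁ w)) (sym (+-suc (suc k) m))) ⟩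
  prefix (suc k +ℕ suc m) (insZ₁ w ⊕ insZ₁ w) ∎

z₁Part-z₂Shuffle : ∀ k n w → Z₁Free w → z₁Part (z₂Shuffle 0 w) ≈ δ w ⊕ δ w →
  z₁Part (z₂Shuffle (suc k) (n ∷ w)) ≈
    prefix (suc k +ℕ n) (δ w ⊕ δ w) ⊕ scale (suc n × 1ℚ) (prefix (suc (suc k +ℕ n)) (insZ₁ w ⊕ insZ₁ w))
z₁Part-z₂Shuffle k zero w free z₁Part-z₂Shuffle-w = begin
  z₁Part (z₂Shuffle (suc k) (0 ∷ w))
    ≡⟨ trans (cong z₁Part (z₂Shuffle-zero (suc k) w))
       (trans (z₁Part-⊕ (prefix (suc k) (z₂Shuffle 0 w)) (yShuffle (suc (suc k)) (0 ∷ w)))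
              (cong (_⊕ z₁Part (yShuffle (suc (suc k)) (0 ∷ w))) (z₁Part-prefix-suc k (z₂Shuffle 0 w)))) ⟩
  prefix (suc k) (z₁Part (z₂Shuffle 0 w)) ⊕ z₁Part (yShuffle (suc (suc k)) (0 ∷ w))
    ≈⟨ ⊕-cong (prefix-cong (suc k) z₁Part-z₂Shuffle-w) (z₁Part-yShuffle (suc k) 0 w free) ⟩
  prefix (suc k) (δ w ⊕ δ w) ⊕ Q
    ≡⟨ cong (λ j → prefix j (δ w ⊕ δ w) ⊕ Q) (+-identityʳ (suc k)) ⟨
  prefix (suc k +ℕ 0) (δ w ⊕ δ w) ⊕ Q
    ≈⟨ ⊕-cong (≈-refl {prefix (suc k +ℕ 0) (δ w ⊕ δ w)})
              (≈-trans (≈-reflexive (cong (λ c → scale c Q) (×-homo-1 1ℚ))) (scale-1 Q)) ⟨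
  prefix (suc k +ℕ 0) (δ w ⊕ δ w) ⊕ scale (1 × 1ℚ) Q ∎
  where Q = prefix (suc (suc k +ℕ 0)) (insZ₁ w ⊕ insZ₁ w)
z₁Part-z₂Shuffle k (suc m) w free z₁Part-z₂Shuffle-w = begin
  z₁Part (z₂Shuffle (suc k) (suc m ∷ w))
    ≡⟨ trans (cong z₁Part (z₂Shuffle-suc (suc k) m w))
             (z₁Part-⊕ (z₂Shuffle (suc (suc k)) (m ∷ w)) (yShuffle (suc (suc k)) (suc m ∷ w))) ⟩
  z₁Part (z₂Shuffle (suc (suc k)) (m ∷ w)) ⊕ z₁Part (yShuffle (suc (suc k)) (suc m ∷ w))
    ≈⟨ ⊕-cong (z₁Part-z₂Shuffle (suc k) m w free z₁Part-z₂Shuffle-w) (z₁Part-yShuffle (suc k) (suc m) w free) ⟩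
  (prefix (suc (suc k) +ℕ m) (δ w ⊕ δ w) ⊕ scale (suc m × 1ℚ) (prefix (suc (suc (suc k) +ℕ m)) (insZ₁ w ⊕ insZ₁ w))) ⊕ Q
    ≡⟨ cong (λ j → (prefix j (δ w ⊕ δ w) ⊕ scale (suc m × 1ℚ) (prefix (suc j) (insZ₁ w ⊕ insZ₁ w))) ⊕ Q)
            (+-suc (suc k) m) ⟨
  (prefix j (δ w ⊕ δ w) ⊕ scale (suc m × 1ℚ) Q) ⊕ Q
    ≈⟨ xy∙z≈x∙zy (prefix j (δ w ⊕ δ w)) (scale (suc m × 1ℚ) Q) Q ⟩
  prefix j (δ w ⊕ δ w) ⊕ Q ⊕ scale (suc m × 1ℚ) Q
    ≈⟨ ⊕-cong (≈-refl {prefix j (δ w ⊕ δ w)}) (scale-suc (suc m) Q) ⟨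
  prefix j (δ w ⊕ δ w) ⊕ scale (suc (suc m) × 1ℚ) Q ∎
  where
  j = suc k +ℕ suc m
  Q = prefix (suc j) (insZ₁ w ⊕ insZ₁ w)

z₁Part-z₂Shuffle-0 : ∀ w → Z₁Free w → z₁Part (z₂Shuffle 0 w) ≈ δ w ⊕ δ w
z₁Part-z₂Shuffle-0 [] _ = ≈-refl
z₁Part-z₂Shuffle-0 (zero ∷ w) (() ∷ _)
z₁Part-z₂Shuffle-0 (suc m ∷ w) (_ ∷ free) = begin
  z₁Part (z₂Shuffle 0 (suc m ∷ w))
    ≡⟨ trans (cong z₁Part (z₂Shuffle-suc 0 m w)) (z₁Part-⊕ (z₂Shuffle 1 (m ∷ w)) (yShuffle 1 (suc m ∷ w))) ⟩
  z₁Part (z₂Shuffle 1 (m ∷ w)) ⊕ z₁Part (yShuffle 1 (suc m ∷ w))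
    ≈⟨ ⊕-cong (z₁Part-z₂Shuffle 0 m w free (z₁Part-z₂Shuffle-0 w free)) (z₁Part-yShuffle 0 (suc m) w free) ⟩
  (prefix (suc m) (δ w ⊕ δ w) ⊕ scale (suc m × 1ℚ) Q) ⊕ Q
    ≈⟨ xy∙z≈x∙zy (prefix (suc m) (δ w ⊕ δ w)) (scale (suc m × 1ℚ) Q) Q ⟩
  prefix (suc m) (δ w ⊕ δ w) ⊕ Q ⊕ scale (suc m × 1ℚ) Q
    ≈⟨ ⊕-cong (≈-refl {prefix (suc m) (δ w ⊕ δ w)}) (scale-suc (suc m) Q) ⟨
  prefix (suc m) (δ w ⊕ δ w) ⊕ scale k Q
    ≡⟨ cong₂ _⊕_ (prefix-⊕ (suc m) (δ w) (δ w))
                 (trans (cong (scale k) (prefix-⊕ (suc (suc m)) (insZ₁ w) (insZ₁ w))) (scale-⊕ k P P)) ⟩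
  (prefix (suc m) (δ w) ⊕ prefix (suc m) (δ w)) ⊕ (scale k P ⊕ scale k P)
    ≈⟨ ⊕-solve 2 (λ d p → (d ⊞ d) ⊞ (p ⊞ p) ⊜ (p ⊞ d) ⊞ (p ⊞ d)) ≈-refl (prefix (suc m) (δ w)) (scale k P) ⟩
  δ (suc m ∷ w) ⊕ δ (suc m ∷ w) ∎
  where
  k = suc (suc m) × 1ℚ
  P = prefix (suc (suc m)) (insZ₁ w)
  Q = prefix (suc (suc m)) (insZ₁ w ⊕ insZ₁ w)

-- φ modulo z₁

z₁Part-φ : ∀ p → In𝔥≥2 p → z₁Part (φ p) ≈ ⊖ (lin δ p ⊕ lin δ p)
z₁Part-φ p p∈𝔥≥2 = begin
  z₁Part ((p ∗ z₂) ⊖ (p ⧢ z₂))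
    ≡⟨ z₁Part-⊖ (p ∗ z₂) (p ⧢ z₂) ⟩
  z₁Part (p ∗ z₂) ⊖ z₁Part (p ⧢ z₂)
    ≈⟨ ⊖-cong (In𝔥≥2⇒z₁Part≈[] (p ∗ z₂) (∗-In𝔥≥2 p z₂ p∈𝔥≥2 z₂∈𝔥≥2)) z₁Part-⧢-z₂ ⟩
  [] ⊖ (lin δ p ⊕ lin δ p) ∎
  where
  z₁Part-⧢-z₂ : z₁Part (p ⧢ z₂) ≈ lin δ p ⊕ lin δ p
  z₁Part-⧢-z₂ = begin
    z₁Part (p ⧢ z₂)                        ≈⟨ z₁Part-cong (bilin-wordʳ shW p (1 ∷ [])) ⟩
    z₁Part (lin (λ u → shW u (1 ∷ [])) p)  ≡⟨ z₁Part-lin _ p ⟩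
    lin (λ u → z₁Part (shW u (1 ∷ []))) p  ≈⟨ lin-congʳ-𝔥≥2 p p∈𝔥≥2 z₁Part-z₂Shuffle-0 ⟩
    lin (λ u → δ u ⊕ δ u) p                ≈⟨ lin-⊕ᶠ δ δ p ⟩
    lin δ p ⊕ lin δ p                      ∎

z₁Part-φ-∗ : ∀ p q → In𝔥≥2 p → In𝔥≥2 q → z₁Part (φ p ∗ q) ≈ ⊖ (z₁Part (lin δ p ∗ q) ⊕ z₁Part (lin δ p ∗ q))
z₁Part-φ-∗ p q p∈𝔥≥2 q∈𝔥≥2 = begin
  z₁Part (φ p ∗ q)                     ≈⟨ z₁Part-∗-z₁Part (φ p) q q∈𝔥≥2 ⟩
  z₁Part (z₁Part (φ p) ∗ q)            ≈⟨ z₁Part-cong (bilin-cong harmW (z₁Part-φ p p∈𝔥≥2) (≈-refl {q})) ⟩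
  z₁Part ((⊖ (D ⊕ D)) ∗ q)             ≈⟨ z₁Part-cong (bilin-scaleˡ harmW (- 1ℚ) (D ⊕ D) q) ⟩
  z₁Part (⊖ ((D ⊕ D) ∗ q))             ≡⟨ z₁Part-scale (- 1ℚ) ((D ⊕ D) ∗ q) ⟩
  ⊖ z₁Part ((D ⊕ D) ∗ q)               ≡⟨ cong ⊖_ (z₁Part-∗-⊕ˡ D D q) ⟩
  ⊖ (z₁Part (D ∗ q) ⊕ z₁Part (D ∗ q))  ∎
  where D = lin δ p

z₁Part-φ-Leibniz : ∀ u v → In𝔥≥2 u → In𝔥≥2 v → z₁Part (φ (u ∗ v)) ≈ z₁Part (φ u ∗ v) ⊕ z₁Part (u ∗ φ v)
z₁Part-φ-Leibniz u v u∈𝔥≥2 v∈𝔥≥2 = begin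
  z₁Part (φ (u ∗ v))                  ≈⟨ z₁Part-φ (u ∗ v) (∗-In𝔥≥2 u v u∈𝔥≥2 v∈𝔥≥2) ⟩
  ⊖ (lin δ (u ∗ v) ⊕ lin δ (u ∗ v))   ≈⟨ scale-cong (- 1ℚ) (⊕-cong δ-Leibniz δ-Leibniz) ⟩
  ⊖ ((X ⊕ Y) ⊕ (X ⊕ Y))               ≈⟨ scale-cong (- 1ℚ) (interchange X Y X Y) ⟩
  ⊖ ((X ⊕ X) ⊕ (Y ⊕ Y))               ≡⟨ scale-⊕ (- 1ℚ) (X ⊕ X) (Y ⊕ Y) ⟩
  ⊖ (X ⊕ X) ⊕ ⊖ (Y ⊕ Y)               ≈⟨ ⊕-cong (z₁Part-φ-∗ u v u∈𝔥≥2 v∈𝔥≥2) z₁Part-∗-φ ⟨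
  z₁Part (φ u ∗ v) ⊕ z₁Part (u ∗ φ v) ∎
  where
  X = z₁Part (lin δ u ∗ v)
  Y = z₁Part (lin δ v ∗ u)
  δ-Leibniz : lin δ (u ∗ v) ≈ X ⊕ Y
  δ-Leibniz = lin-δ-∗ u v u∈𝔥≥2 v∈𝔥≥2
  z₁Part-∗-φ : z₁Part (u ∗ φ v) ≈ ⊖ (Y ⊕ Y)
  z₁Part-∗-φ = ≈-trans (z₁Part-cong (∗-comm u (φ v))) (z₁Part-φ-∗ v u v∈𝔥≥2 u∈𝔥≥2)

lemmaA5 : (u v : Poly) → In𝔥≥2 u → In𝔥≥2 v → In𝔥≥2 (R u v)
lemmaA5 u v u∈𝔥≥2 v∈𝔥≥2 = z₁Part≈[]⇒In𝔥≥2 (R u v) (begin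
  z₁Part (R u v)
    ≡⟨ trans (z₁Part-⊖ (φ (u ∗ v) ⊖ (φ u ∗ v)) (u ∗ φ v))
             (cong (_⊖ z₁Part (u ∗ φ v)) (z₁Part-⊖ (φ (u ∗ v)) (φ u ∗ v))) ⟩
  (z₁Part (φ (u ∗ v)) ⊖ z₁Part (φ u ∗ v)) ⊖ z₁Part (u ∗ φ v)
    ≈⟨ ⊖-⊖-cancel (z₁Part-φ-Leibniz u v u∈𝔥≥2 v∈𝔥≥2) ⟩
  [] ∎)
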